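{- Let $q$ be a prime power, $F=GF(q^2)$, $\overline{c}=c^q$, and let $V=F^3$ with Hermitian form $B(x,y)=x_1\overline{y_2}+x_2\overline{y_1}+x_3\overline{y_3}$. Let $U(3,q^2)$ be the unitary group of $(V,B)$, acting on the set $\mathbb{P}C$ of isotropic lines of $V$ by $\sigma[x]=[\sigma(x)]$. Fix a basis $u,v,w$ of $V$ with $B(u,v)=1=B(w,w)$, $B(u,u)=B(v,v)=0$ and $B(u,w)=B(v,w)=0$, and let $$\Omega'=\{[bu+v+cw]\in\mathbb{P}C: b,c\in F,\ b+\overline{b}+c\overline{c}=0\neq b+\overline{b}\}.$$ Then the stabilizer $U(3,q^2)_{[u],[v]}$ of both $[u]$ and $[v]$ acts on $\Omega'$, and this action has exactly $q$ orbits.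
   Context: $U(3,q^2)$ is the group of $F$-linear automorphisms $\sigma$ of $V$ with $B(\sigma(x),\sigma(y))=B(x,y)$ for all $x,y\in V$. A line $[x]$ (span of a nonzero $x$) is isotropic if $B(x,x)=0$. -}

module Defs where

open import Level using (Level; _⊔_)
open import Data.Nat as ℕ using (ℕ)
open import Data.Nat.Primality using (Prime)
open import Data.Fin using (Fin; zero; suc)
open import Data.List using (List; length)
open import Data.List.Membership.Setoid using ()
open import Data.List.Relation.Unary.Any using (Any)
open import Data.List.Relation.Unary.AllPairs using (AllPairs)
open import Data.Product using (Σ; ∃; ∃-syntax; _×_; _,_)
open import Relation.Nullary using (¬_)
open import Relation.Binary.PropositionalEquality using (_≡_)
open import Algebra.Bundles using (CommutativeRing)

IsPrimePower : ℕ → Set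
IsPrimePower q = Σ ℕ λ p → Σ ℕ λ k → Prime p × (1 ℕ.≤ k) × (q ≡ p ℕ.^ k)

module _ {c ℓ : Level} (R : CommutativeRing c ℓ) where
  open CommutativeRing R hiding (zero)

  IsField : Set (c ⊔ ℓ)
  IsField = (¬ (0# ≈ 1#)) × (∀ x → ¬ (x ≈ 0#) → ∃[ y ] (x * y ≈ 1#))

  HasCardinality : ℕ → Set (c ⊔ ℓ)
  HasCardinality n = Σ (List Carrier) λ xs →
    (length xs ≡ n) × AllPairs (λ a b → ¬ (a ≈ b)) xs × (∀ x → Any (x ≈_) xs)

  pow : Carrier → ℕ → Carrier
  pow x ℕ.zero = 1#
  pow x (ℕ.suc n) = x * pow x n

  V : Set c
  V = Fin 3 → Carrier

  _≈V_ : V → V → Set ℓ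
  x ≈V y = ∀ i → x i ≈ y i

  _+V_ : V → V → V
  (x +V y) i = x i + y i

  _·V_ : Carrier → V → V
  (a ·V x) i = a * x i

  module Hermitian (q : ℕ) where
    conj : Carrier → Carrier
    conj a = pow a q

    B : V → V → Carrier
    B x y = x zero * conj (y (suc zero)) + x (suc zero) * conj (y zero)
          + x (suc (suc zero)) * conj (y (suc (suc zero)))

    record Unitary : Set (c ⊔ ℓ) where
      field
        σ        : V → V
        cong     : ∀ {x y} → x ≈V y → σ x ≈V σ y
        additive : ∀ x y → σ (x +V y) ≈V (σ x +V σ y)
        homog    : ∀ a x → σ (a ·V x) ≈V (a ·V σ x)
        injective  : ∀ x y → σ x ≈V σ y → x ≈V y
        surjective : ∀ y → ∃[ x ] (σ x ≈V y)
        isometry : ∀ x y → B (σ x) (σ y) ≈ B x y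

    SameLine : V → V → Set (c ⊔ ℓ)
    SameLine x y = ∃[ λ′ ] (¬ (λ′ ≈ 0#) × (x ≈V (λ′ ·V y)))

    IsBasis : V → V → V → Set (c ⊔ ℓ)
    IsBasis u v w =
      (∀ a b d → ((a ·V u) +V ((b ·V v) +V (d ·V w))) ≈V (λ _ → 0#)
               → (a ≈ 0#) × (b ≈ 0#) × (d ≈ 0#))
      × (∀ x → ∃[ a ] ∃[ b ] ∃[ d ] (x ≈V ((a ·V u) +V ((b ·V v) +V (d ·V w)))))

    module Config (u v w : V) where
      InΩ′ : V → Set (c ⊔ ℓ)
      InΩ′ x = ∃[ b ] ∃[ d ]
        ( (b + conj b + d * conj d ≈ 0#)
        × ¬ (b + conj b ≈ 0#)
        × B x x ≈ 0#
        × SameLine x ((b ·V u) +V (v +V (d ·V w))))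

      InStab : Unitary → Set (c ⊔ ℓ)
      InStab g = SameLine (Unitary.σ g u) u × SameLine (Unitary.σ g v) v

      SameOrbit : V → V → Set (c ⊔ ℓ)
      SameOrbit x y = ∃[ g ] (InStab g × SameLine (Unitary.σ g x) y)

      StabActsOnΩ′ : Set (c ⊔ ℓ)
      StabActsOnΩ′ = ∀ g x → InStab g → InΩ′ x → InΩ′ (Unitary.σ g x)

      HasOrbitCount : ℕ → Set (c ⊔ ℓ)
      HasOrbitCount n = Σ (Fin n → V) λ r →
          (∀ i → InΩ′ (r i))
        × (∀ i j → SameOrbit (r i) (r j) → i ≡ j)
        × (∀ x → InΩ′ x → ∃[ i ] SameOrbit x (r i))

{-# OPTIONS --safe #-}
module Submission where

-- Every element of the stabiliser of [u] and [v] is diagonal in the basis (u, v, w),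
-- σ = diag(α, β, γ) with α β̄ = γ γ̄ = 1, and every such diagonal map is unitary. It sends
-- [b u + v + d w] to [(b α / β) u + v + (d γ / β) w], which preserves b / (d d̄); conversely
-- points of Ω′ with the same value of b / (d d̄) are related by such a map. So the orbits
-- correspond to the values r = b / (d d̄), which are exactly the elements of trace r + r̄ = -1.
-- In GF(q²), where c ↦ c̄ is an involutive automorphism (Frobenius and Lagrange's theorem),
-- every fibre of the trace over the fixed field GF(q) has exactly q elements.

open import Defs
open import Level using (Level; _⊔_)
open import Algebra.Bundles using (CommutativeRing; CommutativeSemiring; CommutativeMonoid)
open import Data.Empty using (⊥-elim)
open import Data.Fin as Fin using (Fin; zero; suc; toℕ; inject₁; punchIn; punchOut; combine)
open import Data.Fin.Patterns using (0F; 1F; 2F)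
open import Data.Fin.Permutation using (Permutation; permutation; _⟨$⟩ʳ_)
open import Data.Fin.Properties
  using (¬∀⟶∃¬; toℕ-fromℕ; toℕ-inject₁; toℕ<n; punchIn-injective; punchInᵢ≢i; punchIn-punchOut;
         combine-injective; injective⇒≤; 0≢1+n; suc-injective)
open import Data.List using (List; []; _∷_; length; lookup; filter; replicate)
open import Data.List.Properties using (length-replicate)
import Data.List.Relation.Unary.All as All
open import Data.List.Relation.Unary.AllPairs using (_∷_)
import Data.List.Relation.Unary.Any as Any
open import Data.List.Relation.Unary.Any.Properties using (lookup-index)
open import Data.List.Membership.Propositional.Properties using () renaming (∈-lookup to ∈ₚ-lookup)
open import Data.Nat as ℕ using (ℕ; zero; suc; _≤_; _<_; z≤n; s≤s; _!; nonTrivial⇒n>1; nonTrivial⇒nonZero)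
import Data.Nat.Properties as ℕ
open import Data.Nat.Combinatorics using (_C_; nCk≡n!/k![n-k]!; k![n∸k]!∣n!; nCn≡1)
open import Data.Nat.Divisibility using (_∣_; divides; ∣1⇒≡1; ∣⇒≤; m∣m*n)
open import Data.Nat.DivMod using (m/n*n≡m)
open import Data.Nat.Primality using (Prime; euclidsLemma; ¬prime[0]; ¬prime[1]; prime⇒nonTrivial)
import Data.Product
open import Data.Product using (∃-syntax; _×_; _,_; proj₁; proj₂)
open import Data.Sum using (inj₁; inj₂)
open import Data.Vec.Functional using (init; last; tail)
open import Function using (_∘_; id)
open import Function.Definitions using (StrictlyInverseˡ; StrictlyInverseʳ)
open import Relation.Binary using (Setoid; _Respects_; _Preserves_⟶_) renaming (Decidable to Decidable₂)
open import Relation.Binary.PropositionalEquality as ≡ using (_≡_; _≢_)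
open import Relation.Nullary using (¬_; yes; no)
open import Relation.Nullary.Decidable using (map′)
open import Relation.Unary using (Pred; Decidable; U)

p∤m! : ∀ {p} → Prime p → ∀ m → m < p → ¬ (p ∣ m !)
p∤m! p-prime zero _ p∣1 = ¬prime[1] (≡.subst Prime (∣1⇒≡1 p∣1) p-prime)
p∤m! p-prime (suc m) m<p p∣m! with euclidsLemma (suc m) (m !) p-prime p∣m!
... | inj₁ p∣1+m = ℕ.<⇒≱ m<p (∣⇒≤ p∣1+m)
... | inj₂ p∣m!  = p∤m! p-prime m (ℕ.<-trans (ℕ.n<1+n m) m<p) p∣m!

p∣pCk : ∀ {p k} → Prime p → 0 < k → k < p → p ∣ p C k
p∣pCk {p} {k} p-prime 0<k k<p with euclidsLemma (p C k) (k ! ℕ.* (p ℕ.∸ k) !) p-prime p∣product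
  where
  instance _ = k ℕ.!* (p ℕ.∸ k) !≢0
  p∣product : p ∣ (p C k) ℕ.* (k ! ℕ.* (p ℕ.∸ k) !)
  p∣product = ≡.subst (p ∣_) (≡.sym pCk*k![p-k]!≡p!) (p∣p! p (ℕ.<-≤-trans 0<k (ℕ.<⇒≤ k<p)))
    where
    pCk*k![p-k]!≡p! : (p C k) ℕ.* (k ! ℕ.* (p ℕ.∸ k) !) ≡ p !
    pCk*k![p-k]!≡p! = ≡.trans (≡.cong (λ n → n ℕ.* (k ! ℕ.* (p ℕ.∸ k) !)) (nCk≡n!/k![n-k]! (ℕ.<⇒≤ k<p)))
                              (m/n*n≡m (k![n∸k]!∣n! (ℕ.<⇒≤ k<p)))
    p∣p! : ∀ n → 0 < n → n ∣ n !
    p∣p! (suc n) _ = m∣m*n (n !)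
... | inj₁ p∣pCk = p∣pCk
... | inj₂ p∣k![p-k]! with euclidsLemma (k !) ((p ℕ.∸ k) !) p-prime p∣k![p-k]!
...   | inj₁ p∣k!     = ⊥-elim (p∤m! p-prime k k<p p∣k!)
...   | inj₂ p∣[p-k]! = ⊥-elim (p∤m! p-prime (p ℕ.∸ k) (ℕ.∸-monoʳ-< 0<k (ℕ.<⇒≤ k<p)) p∣[p-k]!)

module _ {c ℓ} (S : CommutativeSemiring c ℓ) where
  open CommutativeSemiring S hiding (zero)
  open import Algebra.Properties.Semiring.Exp semiring using (_^_; ^-congˡ; ^-assocʳ)
  open import Algebra.Properties.Semiring.Mult semiring renaming (_×_ to _·_) using (×-congˡ; ×-congʳ; ×-assocˡ; ×-assoc-*)
  open import Algebra.Properties.Semiring.Sum semiring using (sum; sum-init-last; sum-cong-≋; sum-replicate-zero)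
  open import Algebra.Properties.CommutativeSemiring.Binomial S using (theorem; binomialTerm)
  open import Relation.Binary.Reasoning.Setoid setoid

  private
    multiple-of-char-vanishes : ∀ {p} → p · 1# ≈ 0# → ∀ m x → p ∣ m → m · x ≈ 0#
    multiple-of-char-vanishes {p} p·1≈0 m x (divides k ≡.refl) = begin
      (k ℕ.* p) · x          ≈⟨ ×-assocˡ x k p ⟨
      k · (p · x)            ≈⟨ ×-congʳ k p·x≈0 ⟩
      k · 0#                 ≈⟨ zero-multiple k ⟩
      0#                     ∎
      where
      p·x≈0 : p · x ≈ 0#
      p·x≈0 = begin
        p · x                ≈⟨ ×-congʳ p (*-identityˡ x) ⟨
        p · (1# * x)         ≈⟨ ×-assoc-* p 1# x ⟨
        (p · 1#) * x         ≈⟨ *-congʳ p·1≈0 ⟩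
        0# * x               ≈⟨ zeroˡ x ⟩
        0#                   ∎
      zero-multiple : ∀ k → k · 0# ≈ 0#
      zero-multiple zero    = refl
      zero-multiple (suc k) = trans (+-identityˡ _) (zero-multiple k)

  frobenius : ∀ {p} → Prime p → p · 1# ≈ 0# → ∀ x y → (x + y) ^ p ≈ x ^ p + y ^ p
  frobenius {zero}  p-prime = ⊥-elim (¬prime[0] p-prime)
  frobenius {suc n} p-prime p·1≈0 x y = begin
    (x + y) ^ suc n                                 ≈⟨ theorem (suc n) x y ⟩
    T zero + sum (tail T)                           ≈⟨ +-congˡ (sum-init-last (tail T)) ⟩
    T zero + (sum (init (tail T)) + last (tail T))  ≈⟨ +-cong first (+-cong middle final) ⟩
    y ^ suc n + (0# + x ^ suc n)                    ≈⟨ +-congˡ (+-identityˡ _) ⟩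
    y ^ suc n + x ^ suc n                           ≈⟨ +-comm _ _ ⟩
    x ^ suc n + y ^ suc n                           ∎
    where
    T = binomialTerm x y (suc n)
    first : T zero ≈ y ^ suc n
    first = trans (+-identityʳ _) (*-identityˡ _)
    middle : sum (init (tail T)) ≈ 0#
    middle = trans (sum-cong-≋ λ i → multiple-of-char-vanishes p·1≈0 _ _ (p∣pCk p-prime (s≤s z≤n) (s≤s (i<n i))))
                   (sum-replicate-zero n)
      where
      i<n : ∀ (i : Fin n) → toℕ (inject₁ i) < n
      i<n i = ≡.subst (_< n) (≡.sym (toℕ-inject₁ i)) (toℕ<n i)
    final : last (tail T) ≈ x ^ suc n
    final rewrite toℕ-fromℕ n = begin
      (suc n C suc n) · (x ^ suc n * y ^ (n ℕ.∸ n))  ≈⟨ ×-congˡ (nCn≡1 (suc n)) ⟩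
      1 · (x ^ suc n * y ^ (n ℕ.∸ n))                ≈⟨ +-identityʳ _ ⟩
      x ^ suc n * y ^ (n ℕ.∸ n)                      ≈⟨ *-congˡ (reflexive (≡.cong (y ^_) (ℕ.n∸n≡0 n))) ⟩
      x ^ suc n * 1#                                 ≈⟨ *-identityʳ _ ⟩
      x ^ suc n                                      ∎

  frobenius-iterated : ∀ {p} → Prime p → p · 1# ≈ 0# → ∀ k x y → (x + y) ^ (p ℕ.^ k) ≈ x ^ (p ℕ.^ k) + y ^ (p ℕ.^ k)
  frobenius-iterated p-prime p·1≈0 zero x y =
    trans (*-identityʳ _) (+-cong (sym (*-identityʳ x)) (sym (*-identityʳ y)))
  frobenius-iterated {p} p-prime p·1≈0 (suc k) x y = begin
    (x + y) ^ (p ℕ.* p ℕ.^ k)          ≈⟨ ^-assocʳ (x + y) p (p ℕ.^ k) ⟨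
    ((x + y) ^ p) ^ (p ℕ.^ k)          ≈⟨ ^-congˡ (p ℕ.^ k) (frobenius p-prime p·1≈0 x y) ⟩
    (x ^ p + y ^ p) ^ (p ℕ.^ k)        ≈⟨ frobenius-iterated p-prime p·1≈0 k (x ^ p) (y ^ p) ⟩
    (x ^ p) ^ (p ℕ.^ k) + (y ^ p) ^ (p ℕ.^ k)
                                       ≈⟨ +-cong (^-assocʳ x p (p ℕ.^ k)) (^-assocʳ y p (p ℕ.^ k)) ⟩
    x ^ (p ℕ.* p ℕ.^ k) + y ^ (p ℕ.* p ℕ.^ k) ∎

module FieldProperties {c ℓ} (F : CommutativeRing c ℓ) (isField : IsField F) where
  open CommutativeRing F hiding (zero)
  open import Algebra.Properties.Semiring.Exp semiring using (_^_)
  open import Relation.Binary.Reasoning.Setoid setoid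

  pow≡^ : ∀ x n → pow F x n ≡ x ^ n
  pow≡^ x zero    = ≡.refl
  pow≡^ x (suc n) = ≡.cong (x *_) (pow≡^ x n)

  1≉0 : 1# ≉ 0#
  1≉0 1≈0 = proj₁ isField (sym 1≈0)

  inv : ∀ x → x ≉ 0# → Carrier
  inv x x≉0 = proj₁ (proj₂ isField x x≉0)

  inverseʳ : ∀ x (x≉0 : x ≉ 0#) → x * inv x x≉0 ≈ 1#
  inverseʳ x x≉0 = proj₂ (proj₂ isField x x≉0)

  inverseˡ : ∀ x (x≉0 : x ≉ 0#) → inv x x≉0 * x ≈ 1#
  inverseˡ x x≉0 = trans (*-comm _ _) (inverseʳ x x≉0)

  *-cancelˡ : ∀ {x y z} → x ≉ 0# → x * y ≈ x * z → y ≈ z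
  *-cancelˡ {x} {y} {z} x≉0 xy≈xz = begin
    y                  ≈⟨ *-identityˡ y ⟨
    1# * y             ≈⟨ *-congʳ (inverseˡ x x≉0) ⟨
    (inv x x≉0 * x) * y ≈⟨ *-assoc _ _ _ ⟩
    inv x x≉0 * (x * y) ≈⟨ *-congˡ xy≈xz ⟩
    inv x x≉0 * (x * z) ≈⟨ *-assoc _ _ _ ⟨
    (inv x x≉0 * x) * z ≈⟨ *-congʳ (inverseˡ x x≉0) ⟩
    1# * z             ≈⟨ *-identityˡ z ⟩
    z                  ∎

  *-cancelʳ : ∀ {x y z} → x ≉ 0# → y * x ≈ z * x → y ≈ z
  *-cancelʳ x≉0 yx≈zx = *-cancelˡ x≉0 (trans (*-comm _ _) (trans yx≈zx (*-comm _ _)))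

  x*y≈0⇒y≈0 : ∀ {x y} → x ≉ 0# → x * y ≈ 0# → y ≈ 0#
  x*y≈0⇒y≈0 x≉0 xy≈0 = *-cancelˡ x≉0 (trans xy≈0 (sym (zeroʳ _)))

  *-nonzero : ∀ {x y} → x ≉ 0# → y ≉ 0# → x * y ≉ 0#
  *-nonzero x≉0 y≉0 xy≈0 = y≉0 (x*y≈0⇒y≈0 x≉0 xy≈0)

  ^-nonzero : ∀ {x} n → x ≉ 0# → x ^ n ≉ 0#
  ^-nonzero zero    x≉0 = 1≉0
  ^-nonzero (suc n) x≉0 = *-nonzero x≉0 (^-nonzero n x≉0)

  *-inverse-nonzeroˡ : ∀ {x y} → x * y ≈ 1# → x ≉ 0#
  *-inverse-nonzeroˡ {x} {y} xy≈1 x≈0 = 1≉0 (trans (sym xy≈1) (trans (*-congʳ x≈0) (zeroˡ y)))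

  x*z≈y*z⇒z≈0 : ∀ {x y z} → x ≉ y → x * z ≈ y * z → z ≈ 0#
  x*z≈y*z⇒z≈0 {x} {y} {z} x≉y xz≈yz = x*y≈0⇒y≈0 (λ x-y≈0 → x≉y (x∙y⁻¹≈ε⇒x≈y x y x-y≈0)) (begin
    (x - y) * z        ≈⟨ [y-z]x≈yx-zx z x y ⟩
    x * z - y * z      ≈⟨ x≈y⇒x∙y⁻¹≈ε xz≈yz ⟩
    0#                 ∎)
    where open import Algebra.Properties.Ring ring using ([y-z]x≈yx-zx; x∙y⁻¹≈ε⇒x≈y; x≈y⇒x∙y⁻¹≈ε)

  -1≉0 : - 1# ≉ 0#
  -1≉0 -1≈0 = 1≉0 (trans (sym (-‿involutive 1#)) (trans (-‿cong -1≈0) -0#≈0#))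
    where open import Algebra.Properties.Ring ring using (-‿involutive; -0#≈0#)

module Enumerations {c ℓ} (S : Setoid c ℓ) where
  open Setoid S
  open import Data.List.Membership.Setoid S using (_∈_)
  open import Data.List.Membership.Setoid.Properties using (∈-lookup; ∈-filter⁺; ∈-filter⁻)
  open import Data.List.Relation.Unary.Unique.Setoid S using (Unique)
  import Data.List.Relation.Unary.Unique.Setoid.Properties as Unique

  record Enumeration {p} (P : Pred Carrier p) (n : ℕ) : Set (c ⊔ ℓ ⊔ p) where
    field
      enum      : Fin n → Carrier
      injective : ∀ {i j} → enum i ≈ enum j → i ≡ j
      sound     : ∀ i → P (enum i)
      complete  : ∀ {x} → P x → ∃[ i ] x ≈ enum i

    index : ∀ {x} → P x → Fin n
    index = proj₁ ∘ complete

  lookup-injective : ∀ {xs} → Unique xs → ∀ {i j} → lookup xs i ≈ lookup xs j → i ≡ j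
  lookup-injective {_ ∷ _}  _               {zero}  {zero}  _ = ≡.refl
  lookup-injective {_ ∷ xs} (x≉xs ∷ _)      {zero}  {suc j} x≈ = ⊥-elim (All.lookup x≉xs (∈ₚ-lookup j) x≈)
  lookup-injective {_ ∷ xs} (x≉xs ∷ _)      {suc i} {zero}  ≈x = ⊥-elim (All.lookup x≉xs (∈ₚ-lookup i) (sym ≈x))
  lookup-injective {_ ∷ xs} (_ ∷ xs-unique) {suc i} {suc j} eq = ≡.cong suc (lookup-injective xs-unique eq)

  module _ {p} {P : Pred Carrier p} where

    fromUnique : ∀ {xs} → Unique xs → (∀ {x} → P x → x ∈ xs) → (∀ {x} → x ∈ xs → P x) →
                 Enumeration P (length xs)
    fromUnique {xs} unique ⊆xs xs⊆ = record
      { enum      = lookup xs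
      ; injective = lookup-injective unique
      ; sound     = λ i → xs⊆ (∈-lookup S xs i)
      ; complete  = λ Px → Any.index (⊆xs Px) , lookup-index (⊆xs Px)
      }

    filtered : ∀ {xs} → Unique xs → (∀ x → x ∈ xs) → (P? : Decidable P) → P Respects _≈_ →
               Enumeration P (length (filter P? xs))
    filtered {xs} unique all∈ P? resp =
      fromUnique (Unique.filter⁺ S P? {xs} unique) (λ Px → ∈-filter⁺ S P? resp (all∈ _) Px)
                 (λ x∈ → proj₂ (∈-filter⁻ S P? resp {xs = xs} x∈))

    without : ∀ {n} (E : Enumeration P (suc n)) (i : Fin (suc n)) →
              Enumeration (λ x → P x × x ≉ Enumeration.enum E i) n
    without E i = record
      { enum      = enum ∘ punchIn i
      ; injective = λ eq → punchIn-injective i _ _ (injective eq)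
      ; sound     = λ j → sound (punchIn i j) , λ eq → punchInᵢ≢i i j (injective eq)
      ; complete  = complete′
      }
      where
      open Enumeration E
      complete′ : ∀ {x} → P x × x ≉ enum i → ∃[ j ] x ≈ enum (punchIn i j)
      complete′ (Px , x≉) with complete Px
      ... | k , x≈k = punchOut k≢i , trans x≈k (reflexive (≡.cong enum (≡.sym (punchIn-punchOut k≢i))))
        where
        k≢i : i ≢ k
        k≢i i≡k = x≉ (trans x≈k (reflexive (≡.cong enum (≡.sym i≡k))))

  index-injective : ∀ {p} {P : Pred Carrier p} {n} (E : Enumeration P n) {x y} (Px : P x) (Py : P y) →
                    Enumeration.index E Px ≡ Enumeration.index E Py → x ≈ y
  index-injective E Px Py eq =
    trans (proj₂ (complete Px)) (trans (reflexive (≡.cong enum eq)) (sym (proj₂ (complete Py))))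
    where open Enumeration E

  ≈-decidable : ∀ {n} → Enumeration U n → Decidable₂ _≈_
  ≈-decidable E x y = map′ (index-injective E _ _) index-≡ (index {x} _ Fin.≟ index {y} _)
    where
    open Enumeration E
    index-≡ : x ≈ y → index {x} _ ≡ index {y} _
    index-≡ x≈y = injective (trans (sym (proj₂ (complete {x} _))) (trans x≈y (proj₂ (complete {y} _))))

  ≤-*-byPairInjection : ∀ {p q r} {P : Pred Carrier p} {Q : Pred Carrier q} {R : Pred Carrier r} {m a b} →
    Enumeration P m → Enumeration Q a → Enumeration R b →
    (f g : Carrier → Carrier) → (∀ {x} → P x → Q (f x)) → (∀ {x} → P x → R (g x)) →
    (∀ {x y} → f x ≈ f y → g x ≈ g y → x ≈ y) → m ≤ a ℕ.* b
  ≤-*-byPairInjection EP EQ ER f g P⇒Qf P⇒Rg f,g-injective = injective⇒≤ pair-injective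
    where
    open Enumeration
    indexQ indexR : Fin _ → Fin _
    indexQ i = index EQ (P⇒Qf (sound EP i))
    indexR i = index ER (P⇒Rg (sound EP i))
    pair-injective : ∀ {i j} → combine (indexQ i) (indexR i) ≡ combine (indexQ j) (indexR j) → i ≡ j
    pair-injective {i} {j} eq with combine-injective (indexQ i) (indexR i) (indexQ j) (indexR j) eq
    ... | Qi≡Qj , Ri≡Rj = injective EP (f,g-injective (index-injective EQ _ _ Qi≡Qj) (index-injective ER _ _ Ri≡Rj))

module _ {c ℓ} (M : CommutativeMonoid c ℓ) where
  open CommutativeMonoid M
  open Enumerations setoid
  open import Algebra.Properties.CommutativeMonoid.Sum M using (sum; sum-cong-≋; sum-permute; sum-replicate; ∑-distrib-+)
  open import Algebra.Properties.Monoid.Mult monoid renaming (_×_ to _·_) using ()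
  open import Relation.Binary.Reasoning.Setoid setoid

  module _ {p} {P : Pred Carrier p} {n} (E : Enumeration P n) where
    open Enumeration E

    sum-invariant : ∀ {h h⁻ : Carrier → Carrier} → h Preserves _≈_ ⟶ _≈_ → h⁻ Preserves _≈_ ⟶ _≈_ →
                    (∀ {x} → P x → P (h x)) → (∀ {x} → P x → P (h⁻ x)) →
                    StrictlyInverseˡ _≈_ h h⁻ → StrictlyInverseʳ _≈_ h h⁻ → sum (h ∘ enum) ≈ sum enum
    sum-invariant {h} {h⁻} h-cong h⁻-cong P⇒Ph P⇒Ph⁻ h∘h⁻ h⁻∘h = begin
      sum (h ∘ enum)                           ≈⟨ sum-cong-≋ (λ i → proj₂ (move i)) ⟩
      sum (enum ∘ (π ⟨$⟩ʳ_))                   ≈⟨ sum-permute enum π ⟨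
      sum enum                                 ∎
      where
      move : ∀ i → ∃[ j ] h (enum i) ≈ enum j
      move i = complete (P⇒Ph (sound i))
      back : ∀ i → ∃[ j ] h⁻ (enum i) ≈ enum j
      back i = complete (P⇒Ph⁻ (sound i))
      π : Permutation n n
      π = permutation (proj₁ ∘ move) (proj₁ ∘ back)
        (λ i → injective (trans (sym (proj₂ (move _))) (trans (h-cong (sym (proj₂ (back i)))) (h∘h⁻ _))))
        (λ i → injective (trans (sym (proj₂ (back _))) (trans (h⁻-cong (sym (proj₂ (move i)))) (h⁻∘h _))))

    sum-translate : ∀ {a b} → a ∙ b ≈ ε → (∀ {x} → P x → P (a ∙ x)) → (∀ {x} → P x → P (b ∙ x)) →
                    n · a ∙ sum enum ≈ sum enum
    sum-translate {a} {b} a∙b≈ε P⇒Pa∙ P⇒Pb∙ = begin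
      n · a ∙ sum enum                         ≈⟨ ∙-congʳ (sum-replicate n) ⟨
      sum {n} (λ _ → a) ∙ sum enum             ≈⟨ ∑-distrib-+ (λ _ → a) enum ⟨
      sum (λ i → a ∙ enum i)                   ≈⟨ sum-invariant (∙-congˡ) (∙-congˡ) P⇒Pa∙ P⇒Pb∙ (cancel a∙b≈ε) (cancel (trans (comm b a) a∙b≈ε)) ⟩
      sum enum                                 ∎
      where
      cancel : ∀ {s t} → s ∙ t ≈ ε → ∀ x → s ∙ (t ∙ x) ≈ x
      cancel {s} {t} s∙t≈ε x = trans (sym (assoc s t x)) (trans (∙-congʳ s∙t≈ε) (identityˡ x))

module MonicPolynomials {c ℓ} (F : CommutativeRing c ℓ) (isField : IsField F) where
  open CommutativeRing F hiding (zero)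
  open FieldProperties F isField
  open import Algebra.Properties.Semiring.Exp semiring using (_^_)
  open import Algebra.Solver.Ring.NaturalCoefficients.Default commutativeSemiring
  open import Relation.Binary.Reasoning.Setoid setoid

  -- cs = c₀ ∷ … ∷ cₙ₋₁ stands for the monic polynomial c₀ + c₁ X + … + cₙ₋₁ Xⁿ⁻¹ + Xⁿ.
  eval : List Carrier → Carrier → Carrier
  eval []       x = 1#
  eval (c ∷ cs) x = c + x * eval cs x

  divide : Carrier → List Carrier → List Carrier
  divide r []                 = []
  divide r (c ∷ [])           = []
  divide r (c ∷ cs@(_ ∷ _))   = eval cs r ∷ divide r cs

  length-divide : ∀ r c cs → length (divide r (c ∷ cs)) ≡ length cs
  length-divide r c []       = ≡.refl
  length-divide r c (d ∷ cs) = ≡.cong suc (length-divide r d cs)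

  -- f(x) - f(r) = (x - r) · (f ÷ (X - r))(x), rearranged so that no subtraction occurs
  eval-divide : ∀ r c cs x → let g = divide r (c ∷ cs) in
                eval (c ∷ cs) x + r * eval g x ≈ x * eval g x + eval (c ∷ cs) r
  eval-divide r c [] x = solve 3 (λ r c x → (c :+ x :* con 1) :+ r :* con 1 := x :* con 1 :+ (c :+ r :* con 1)) refl r c x
  eval-divide r c (d ∷ cs) x = begin
    (c + x * f) + r * (fr + x * g)   ≈⟨ solve 6 (λ c x f r fr g → (c :+ x :* f) :+ r :* (fr :+ x :* g)
                                                                := (c :+ r :* fr) :+ x :* (f :+ r :* g)) refl c x f r fr g ⟩
    (c + r * fr) + x * (f + r * g)   ≈⟨ +-congˡ (*-congˡ (eval-divide r d cs x)) ⟩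
    (c + r * fr) + x * (x * g + fr)  ≈⟨ solve 5 (λ c x r fr g → (c :+ r :* fr) :+ x :* (x :* g :+ fr)
                                                              := x :* (fr :+ x :* g) :+ (c :+ r :* fr)) refl c x r fr g ⟩
    x * (fr + x * g) + (c + r * fr)  ∎
    where
    f  = eval (d ∷ cs) x
    fr = eval (d ∷ cs) r
    g  = eval (divide r (d ∷ cs)) x

  root-bound : ∀ cs {m} (r : Fin m → Carrier) → (∀ {i j} → r i ≈ r j → i ≡ j) →
               (∀ i → eval cs (r i) ≈ 0#) → m ≤ length cs
  root-bound cs       {zero}  r _ _ = z≤n
  root-bound []       {suc m} r _ roots = ⊥-elim (1≉0 (roots zero))
  root-bound (c ∷ cs) {suc m} r r-injective roots =
    s≤s (≡.subst (m ≤_) (length-divide (r zero) c cs)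
      (root-bound (divide (r zero) (c ∷ cs)) (r ∘ suc) (suc-injective ∘ r-injective) quotient-roots))
    where
    quotient-roots : ∀ i → eval (divide (r zero) (c ∷ cs)) (r (suc i)) ≈ 0#
    quotient-roots i = x*z≈y*z⇒z≈0 (λ r₀≈rᵢ → 0≢1+n (r-injective r₀≈rᵢ)) (begin
      r zero * g                                ≈⟨ +-identityˡ _ ⟨
      0# + r zero * g                           ≈⟨ +-congʳ (roots (suc i)) ⟨
      eval (c ∷ cs) (r (suc i)) + r zero * g    ≈⟨ eval-divide (r zero) c cs (r (suc i)) ⟩
      r (suc i) * g + eval (c ∷ cs) (r zero)    ≈⟨ +-congˡ (roots zero) ⟩
      r (suc i) * g + 0#                        ≈⟨ +-identityʳ _ ⟩
      r (suc i) * g                             ∎)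
      where g = eval (divide (r zero) (c ∷ cs)) (r (suc i))

  eval-trinomial : ∀ a b m x → eval (a ∷ b ∷ replicate m 0#) x ≈ a + (b * x + x ^ suc (suc m))
  eval-trinomial a b m x = begin
    a + x * (b + x * eval (replicate m 0#) x)  ≈⟨ +-congˡ (*-congˡ (+-congˡ (*-congˡ (eval-monomial m)))) ⟩
    a + x * (b + x * x ^ m)                    ≈⟨ +-congˡ (distribˡ x b (x * x ^ m)) ⟩
    a + (x * b + x * (x * x ^ m))              ≈⟨ +-congˡ (+-congʳ (*-comm x b)) ⟩
    a + (b * x + x ^ suc (suc m))              ∎
    where
    eval-monomial : ∀ m → eval (replicate m 0#) x ≈ x ^ m
    eval-monomial zero    = refl
    eval-monomial (suc m) = trans (+-identityˡ _) (*-congˡ (eval-monomial m))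

  trinomial-root-bound : ∀ a b m {k} (r : Fin k → Carrier) → (∀ {i j} → r i ≈ r j → i ≡ j) →
                         (∀ i → a + (b * r i + r i ^ suc (suc m)) ≈ 0#) → k ≤ suc (suc m)
  trinomial-root-bound a b m {k} r r-injective roots =
    ≡.subst (k ≤_) (≡.cong (λ n → suc (suc n)) (length-replicate m))
      (root-bound (a ∷ b ∷ replicate m 0#) r r-injective (λ i → trans (eval-trinomial a b m (r i)) (roots i)))

-- x ↦ x ^ q is multiplicative anyway, so these make it an involutive automorphism of F.
record IsConjugation {c ℓ} (F : CommutativeRing c ℓ) (q : ℕ) : Set (c ⊔ ℓ) where
  open CommutativeRing F
  open Hermitian F q using (conj)
  field
    conj-homo-+     : ∀ x y → conj (x + y) ≈ conj x + conj y
    conj-involutive : ∀ x → conj (conj x) ≈ x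

module Conjugation {c ℓ} (F : CommutativeRing c ℓ) (isField : IsField F) (q : ℕ)
                   (isConjugation : IsConjugation F q) where
  open CommutativeRing F hiding (zero)
  open Hermitian F q using (conj) public
  open IsConjugation isConjugation public
  open FieldProperties F isField
  open import Algebra.Properties.Semiring.Exp semiring using (_^_; ^-congˡ)
  open import Algebra.Properties.CommutativeSemiring.Exp commutativeSemiring using (^-distrib-*)
  open import Algebra.Properties.Ring ring using (+-identityˡ-unique; +-inverseʳ-unique)
  open import Relation.Binary.Reasoning.Setoid setoid

  conj≈^ : ∀ x → conj x ≈ x ^ q
  conj≈^ x = reflexive (pow≡^ x q)

  conj-cong : ∀ {x y} → x ≈ y → conj x ≈ conj y
  conj-cong {x} {y} x≈y = trans (conj≈^ x) (trans (^-congˡ q x≈y) (sym (conj≈^ y)))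

  conj-homo-* : ∀ x y → conj (x * y) ≈ conj x * conj y
  conj-homo-* x y = trans (conj≈^ (x * y)) (trans (^-distrib-* x y q) (sym (*-cong (conj≈^ x) (conj≈^ y))))

  conj-1 : conj 1# ≈ 1#
  conj-1 = trans (conj≈^ 1#) (one-power q)
    where
    one-power : ∀ n → 1# ^ n ≈ 1#
    one-power zero    = refl
    one-power (suc n) = trans (*-identityˡ _) (one-power n)

  conj-0 : conj 0# ≈ 0#
  conj-0 = +-identityˡ-unique (conj 0#) (conj 0#)
    (trans (sym (conj-homo-+ 0# 0#)) (conj-cong (+-identityˡ 0#)))

  conj-homo-- : ∀ x → conj (- x) ≈ - conj x
  conj-homo-- x = +-inverseʳ-unique (conj x) (conj (- x))
    (trans (sym (conj-homo-+ x (- x))) (trans (conj-cong (-‿inverseʳ x)) conj-0))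

  conj-nonzero : ∀ {x} → x ≉ 0# → conj x ≉ 0#
  conj-nonzero {x} x≉0 conj-x≈0 = x≉0 (trans (sym (conj-involutive x)) (trans (conj-cong conj-x≈0) conj-0))

  SelfConjugate : Pred Carrier ℓ
  SelfConjugate x = conj x ≈ x

  selfConjugate-resp : SelfConjugate Respects _≈_
  selfConjugate-resp x≈y conj-x≈x = trans (conj-cong (sym x≈y)) (trans conj-x≈x x≈y)

  selfConjugate-+ : ∀ {s t} → SelfConjugate s → SelfConjugate t → SelfConjugate (s + t)
  selfConjugate-+ {s} {t} s-sc t-sc = trans (conj-homo-+ s t) (+-cong s-sc t-sc)

  selfConjugate-- : ∀ {s} → SelfConjugate s → SelfConjugate (- s)
  selfConjugate-- {s} s-sc = trans (conj-homo-- s) (-‿cong s-sc)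

  selfConjugate-inv : ∀ {s} (s≉0 : s ≉ 0#) → SelfConjugate s → SelfConjugate (inv s s≉0)
  selfConjugate-inv {s} s≉0 s-sc = *-cancelʳ s≉0 (begin
    conj (inv s s≉0) * s        ≈⟨ *-congˡ s-sc ⟨
    conj (inv s s≉0) * conj s   ≈⟨ conj-homo-* _ s ⟨
    conj (inv s s≉0 * s)        ≈⟨ conj-cong (inverseˡ s s≉0) ⟩
    conj 1#                     ≈⟨ conj-1 ⟩
    1#                          ≈⟨ inverseˡ s s≉0 ⟨
    inv s s≉0 * s               ∎)

  Tr : Carrier → Carrier
  Tr x = x + conj x

  Tr-cong : ∀ {x y} → x ≈ y → Tr x ≈ Tr y
  Tr-cong x≈y = +-cong x≈y (conj-cong x≈y)

  Tr-selfConjugate : ∀ x → SelfConjugate (Tr x)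
  Tr-selfConjugate x = trans (conj-homo-+ x (conj x)) (trans (+-congˡ (conj-involutive x)) (+-comm _ _))

  Tr-homo-+ : ∀ x y → Tr (x + y) ≈ Tr x + Tr y
  Tr-homo-+ x y = trans (+-congˡ (conj-homo-+ x y)) (solve 4 (λ x y x̄ ȳ → (x :+ y) :+ (x̄ :+ ȳ) := (x :+ x̄) :+ (y :+ ȳ)) refl x y (conj x) (conj y))
    where open import Algebra.Solver.Ring.NaturalCoefficients.Default commutativeSemiring

  Tr-scale : ∀ {s} → SelfConjugate s → ∀ x → Tr (s * x) ≈ s * Tr x
  Tr-scale {s} s-sc x = trans (+-congˡ (trans (conj-homo-* s x) (*-congʳ s-sc))) (sym (distribˡ s x (conj x)))

  norm : Carrier → Carrier
  norm x = x * conj x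

  norm-selfConjugate : ∀ x → SelfConjugate (norm x)
  norm-selfConjugate x = trans (conj-homo-* x (conj x)) (trans (*-congˡ (conj-involutive x)) (*-comm _ _))

  norm-nonzero : ∀ {x} → x ≉ 0# → norm x ≉ 0#
  norm-nonzero x≉0 = *-nonzero x≉0 (conj-nonzero x≉0)

  norm-1 : norm 1# ≈ 1#
  norm-1 = trans (*-identityˡ _) conj-1

  norm-homo-* : ∀ x y → norm (x * y) ≈ norm x * norm y
  norm-homo-* x y = trans (*-congˡ (conj-homo-* x y))
    (solve 4 (λ x y x̄ ȳ → (x :* y) :* (x̄ :* ȳ) := (x :* x̄) :* (y :* ȳ)) refl x y (conj x) (conj y))
    where open import Algebra.Solver.Ring.NaturalCoefficients.Default commutativeSemiring

  x*conj-y≈1⇒y≉0 : ∀ {x y} → x * conj y ≈ 1# → y ≉ 0#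
  x*conj-y≈1⇒y≉0 xȳ≈1 y≈0 = *-inverse-nonzeroˡ (trans (*-comm _ _) xȳ≈1) (trans (conj-cong y≈0) conj-0)

≤-*-squeeze : ∀ {q a b} → a ≤ q → b ≤ q → q ℕ.* q ≤ a ℕ.* b → b ≡ q
≤-*-squeeze {zero}  _   b≤0 _       = ℕ.n≤0⇒n≡0 b≤0
≤-*-squeeze {suc q} {a} {b} a≤q b≤q qq≤ab =
  ℕ.≤-antisym b≤q (ℕ.*-cancelˡ-≤ (suc q) (ℕ.≤-trans qq≤ab (ℕ.*-monoˡ-≤ b a≤q)))

module FieldOfSquareOrder {c ℓ} (F : CommutativeRing c ℓ) (isField : IsField F) (q : ℕ)
                          (q-primePower : IsPrimePower q) (card : HasCardinality F (q ℕ.^ 2)) where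
  open CommutativeRing F hiding (zero)
  open FieldProperties F isField
  open MonicPolynomials F isField
  open Enumerations setoid
  open import Algebra.Properties.Semiring.Exp semiring using (_^_; ^-assocʳ)
  open import Algebra.Properties.Semiring.Mult semiring renaming (_×_ to _·_) using (×1-homo-*)
  open import Algebra.Properties.Ring ring using (+-identityˡ-unique)
  open import Algebra.Properties.Monoid.Sum *-monoid using () renaming (sum to product)
  open import Relation.Binary.Reasoning.Setoid setoid

  private
    p       = proj₁ q-primePower
    k       = proj₁ (proj₂ q-primePower)
    p-prime = proj₁ (proj₂ (proj₂ q-primePower))
    1≤k     = proj₁ (proj₂ (proj₂ (proj₂ q-primePower)))
    q≡p^k   = proj₂ (proj₂ (proj₂ (proj₂ q-primePower)))
    xs      = proj₁ card
    xs-unique   = proj₁ (proj₂ (proj₂ card))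
    xs-complete = proj₂ (proj₂ (proj₂ card))

  2≤q : 2 ≤ q
  2≤q = ≡.subst (2 ≤_) (≡.sym q≡p^k) (ℕ.≤-trans 2≤p (ℕ.≤-trans (ℕ.≤-reflexive (≡.sym (ℕ.*-identityʳ p))) (ℕ.^-monoʳ-≤ p 1≤k)))
    where
    instance _ = prime⇒nonTrivial p-prime
    2≤p : 2 ≤ p
    2≤p = nonTrivial⇒n>1 p
    instance _ = nonTrivial⇒nonZero p

  elements : Enumeration U (q ℕ.^ 2)
  elements = ≡.subst (Enumeration U) (proj₁ (proj₂ card)) (fromUnique xs-unique (λ {x} _ → xs-complete x) _)

  _≟_ : Decidable₂ _≈_
  _≟_ = ≈-decidable elements

  -- Lagrange for (F, +): translation by x permutes F, so q² · x + ∑ F = ∑ F.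
  q²·x≈0 : ∀ x → (q ℕ.^ 2) · x ≈ 0#
  q²·x≈0 x = +-identityˡ-unique _ _ (sum-translate +-commutativeMonoid elements (-‿inverseʳ x) _ _)

  -- (p · 1)^(2k) = q² · 1 = 0, and F has no nilpotents.
  p·1≈0 : p · 1# ≈ 0#
  p·1≈0 with (p · 1#) ≟ 0#
  ... | yes p·1≈0 = p·1≈0
  ... | no  p·1≉0 = ⊥-elim (^-nonzero (k ℕ.* 2) p·1≉0 (begin
    (p · 1#) ^ (k ℕ.* 2)    ≈⟨ ·1-homo-^ p (k ℕ.* 2) ⟩
    (p ℕ.^ (k ℕ.* 2)) · 1#  ≡⟨ ≡.cong (_· 1#) (≡.trans (≡.sym (ℕ.^-*-assoc p k 2)) (≡.cong (ℕ._^ 2) (≡.sym q≡p^k))) ⟩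
    (q ℕ.^ 2) · 1#          ≈⟨ q²·x≈0 1# ⟩
    0#                      ∎))
    where
    ·1-homo-^ : ∀ n m → (n · 1#) ^ m ≈ (n ℕ.^ m) · 1#
    ·1-homo-^ n zero    = sym (+-identityʳ 1#)
    ·1-homo-^ n (suc m) = trans (*-congˡ (·1-homo-^ n m)) (sym (×1-homo-* n (n ℕ.^ m)))

  -- Lagrange for the units: multiplication by x ≉ 0 permutes them, so x^(q² - 1) ∏ units = ∏ units.
  fermat : ∀ x → x ^ (q ℕ.^ 2) ≈ x
  fermat x = ≡.subst (λ N → x ^ N ≈ x) (ℕ.suc-pred (q ℕ.^ 2)) (fermat′ x)
    where
    instance
      _ = ℕ.>-nonZero (ℕ.≤-trans (s≤s z≤n) 2≤q)
      _ = ℕ.m^n≢0 q 2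
    n = ℕ.pred (q ℕ.^ 2)
    elements′ : Enumeration U (suc n)
    elements′ = ≡.subst (Enumeration U) (≡.sym (ℕ.suc-pred (q ℕ.^ 2))) elements
    open Enumeration elements′ using (enum; complete)
    zero-index = proj₁ (complete {0#} _)
    NonZero′ : Pred Carrier ℓ
    NonZero′ x = U x × x ≉ enum zero-index
    nonzero : ∀ {x} → NonZero′ x → x ≉ 0#
    nonzero (_ , x≉) x≈0 = x≉ (trans x≈0 (proj₂ (complete {0#} _)))
    nonzero⁻ : ∀ {x} → x ≉ 0# → NonZero′ x
    nonzero⁻ x≉0 = _ , λ x≈ → x≉0 (trans x≈ (sym (proj₂ (complete {0#} _))))
    units : Enumeration NonZero′ n
    units = without elements′ zero-index
    product-nonzero : ∀ {m} (f : Fin m → Carrier) → (∀ i → f i ≉ 0#) → product f ≉ 0#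
    product-nonzero {zero}  f _  = 1≉0
    product-nonzero {suc m} f f≉0 = *-nonzero (f≉0 zero) (product-nonzero (f ∘ suc) (f≉0 ∘ suc))
    fermat′ : ∀ x → x ^ suc n ≈ x
    fermat′ x with x ≟ 0#
    ... | yes x≈0 = trans (*-congʳ x≈0) (trans (zeroˡ _) (sym x≈0))
    ... | no  x≉0 = trans (*-congˡ xⁿ≈1) (*-identityʳ x)
      where
      ∏units≉0 = product-nonzero (Enumeration.enum units) (nonzero ∘ Enumeration.sound units)
      xⁿ≈1 : x ^ n ≈ 1#
      xⁿ≈1 = *-cancelʳ ∏units≉0 (trans
        (sum-translate *-commutativeMonoid units (inverseʳ x x≉0)
          (λ u → nonzero⁻ (*-nonzero x≉0 (nonzero u)))
          (λ u → nonzero⁻ (*-nonzero (*-inverse-nonzeroˡ (inverseˡ x x≉0)) (nonzero u))))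
        (sym (*-identityˡ _)))

  isConjugation : IsConjugation F q
  isConjugation = record
    { conj-homo-+     = λ x y → ≡.subst (λ n → pow F (x + y) n ≈ pow F x n + pow F y n) (≡.sym q≡p^k)
                          (pow-frobenius k x y)
    ; conj-involutive = λ x → begin
        pow F (pow F x q) q    ≡⟨ ≡.trans (pow≡^ _ q) (≡.cong (_^ q) (pow≡^ x q)) ⟩
        (x ^ q) ^ q            ≈⟨ ^-assocʳ x q q ⟩
        x ^ (q ℕ.* q)          ≡⟨ ≡.cong (λ n → x ^ (q ℕ.* n)) (≡.sym (ℕ.*-identityʳ q)) ⟩
        x ^ (q ℕ.^ 2)          ≈⟨ fermat x ⟩
        x                      ∎
    }
    where
    pow-frobenius : ∀ j x y → pow F (x + y) (p ℕ.^ j) ≈ pow F x (p ℕ.^ j) + pow F y (p ℕ.^ j)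
    pow-frobenius j x y rewrite pow≡^ (x + y) (p ℕ.^ j) | pow≡^ x (p ℕ.^ j) | pow≡^ y (p ℕ.^ j) =
      frobenius-iterated commutativeSemiring p-prime p·1≈0 j x y

  open Conjugation F isField q isConjugation public

  q-root-bound : ∀ a b {n} (r : Fin n → Carrier) → (∀ {i j} → r i ≈ r j → i ≡ j) →
                 (∀ i → a + (b * r i + conj (r i)) ≈ 0#) → n ≤ q
  q-root-bound a b r r-injective roots with q ℕ.∸ 2 | ℕ.m+[n∸m]≡n 2≤q
  ... | m | ≡.refl = trinomial-root-bound a b m r r-injective
                       (λ i → trans (+-congˡ (+-congˡ (sym (conj≈^ (r i))))) (roots i))

  private
    q<q² : q < q ℕ.^ 2
    q<q² = ≡.subst (_< q ℕ.^ 2) (ℕ.*-identityʳ q)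
      (ℕ.*-monoʳ-< q (≡.subst (1 <_) (≡.sym (ℕ.*-identityʳ q)) 2≤q))
      where instance _ = ℕ.>-nonZero (ℕ.≤-trans (s≤s z≤n) 2≤q)

  selfConjugate? : Decidable SelfConjugate
  selfConjugate? x = conj x ≟ x

  selfConjugates : Enumeration SelfConjugate (length (filter selfConjugate? xs))
  selfConjugates = filtered xs-unique xs-complete selfConjugate? selfConjugate-resp

  selfConjugates-≤q : length (filter selfConjugate? xs) ≤ q
  selfConjugates-≤q = q-root-bound 0# (- 1#) enum injective λ i → begin
    0# + (- 1# * enum i + conj (enum i))  ≈⟨ +-identityˡ _ ⟩
    - 1# * enum i + conj (enum i)         ≈⟨ +-cong (-1*x≈-x (enum i)) (sound i) ⟩
    - enum i + enum i                     ≈⟨ -‿inverseˡ (enum i) ⟩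
    0#                                    ∎
    where
    open Enumeration selfConjugates
    open import Algebra.Properties.Ring ring using (-1*x≈-x)

  nonzero-trace : ∃[ r ] Tr r ≉ 0#
  nonzero-trace = Data.Product.map enum id
    (¬∀⟶∃¬ (q ℕ.^ 2) (λ i → Tr (enum i) ≈ 0#) (λ i → Tr (enum i) ≟ 0#) not-all-traceless)
    where
    open Enumeration elements
    not-all-traceless : ¬ (∀ i → Tr (enum i) ≈ 0#)
    not-all-traceless Tr≈0 = ℕ.<⇒≱ q<q² (q-root-bound 0# 1# enum injective
      (λ i → trans (+-identityˡ _) (trans (+-congʳ (*-identityˡ _)) (Tr≈0 i))))

  unit-trace : ∃[ θ ] Tr θ ≈ 1#
  unit-trace with nonzero-trace
  ... | r , Tr-r≉0 = inv (Tr r) Tr-r≉0 * r ,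
    trans (Tr-scale (selfConjugate-inv Tr-r≉0 (Tr-selfConjugate r)) r) (inverseˡ (Tr r) Tr-r≉0)

  -- Every trace fibre over a self-conjugate t has at most q elements (roots of X^q + X - t),
  -- and x ↦ (Tr x , x + (t - Tr x) θ) embeds F, of size q², into (self-conjugates) × (fibre over t).
  trace-fibre : ∀ {t} → SelfConjugate t → Enumeration (λ x → Tr x ≈ t) q
  trace-fibre {t} t-sc = ≡.subst (Enumeration _) (≤-*-squeeze selfConjugates-≤q fibre-≤q q*q≤) fibre
    where
    fibre? : Decidable (λ x → Tr x ≈ t)
    fibre? x = Tr x ≟ t
    fibre = filtered xs-unique xs-complete fibre? (λ x≈y Tr-x≈t → trans (Tr-cong (sym x≈y)) Tr-x≈t)
    open Enumeration fibre
    fibre-≤q = q-root-bound (- t) 1# enum injective λ i → begin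
      - t + (1# * enum i + conj (enum i))   ≈⟨ +-congˡ (+-congʳ (*-identityˡ (enum i))) ⟩
      - t + Tr (enum i)                     ≈⟨ +-congˡ (sound i) ⟩
      - t + t                               ≈⟨ -‿inverseˡ t ⟩
      0#                                    ∎
    θ = proj₁ unit-trace
    shift : Carrier → Carrier
    shift x = x + (t - Tr x) * θ
    Tr-shift : ∀ x → Tr (shift x) ≈ t
    Tr-shift x = begin
      Tr (x + (t - Tr x) * θ)            ≈⟨ Tr-homo-+ x _ ⟩
      Tr x + Tr ((t - Tr x) * θ)         ≈⟨ +-congˡ (Tr-scale (selfConjugate-+ t-sc (selfConjugate-- (Tr-selfConjugate x))) θ) ⟩
      Tr x + (t - Tr x) * Tr θ           ≈⟨ +-congˡ (trans (*-congˡ (proj₂ unit-trace)) (*-identityʳ _)) ⟩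
      Tr x + (t - Tr x)                  ≈⟨ +-assoc (Tr x) t (- Tr x) ⟨
      Tr x + t - Tr x                    ≈⟨ xyx⁻¹≈y (Tr x) t ⟩
      t                                  ∎
      where open import Algebra.Properties.Ring ring using (xyx⁻¹≈y)
    shift-injective : ∀ {x y} → Tr x ≈ Tr y → shift x ≈ shift y → x ≈ y
    shift-injective Tr-x≈Tr-y shift-x≈shift-y = +-cancelʳ _ _ _
      (trans shift-x≈shift-y (+-congˡ (*-congʳ (+-congˡ (-‿cong (sym Tr-x≈Tr-y))))))
      where open import Algebra.Properties.Ring ring using (+-cancelʳ)
    q*q≤ : q ℕ.* q ≤ length (filter selfConjugate? xs) ℕ.* length (filter fibre? xs)
    q*q≤ = ≡.subst (_≤ length (filter selfConjugate? xs) ℕ.* length (filter fibre? xs)) (≡.cong (q ℕ.*_) (ℕ.*-identityʳ q))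
      (≤-*-byPairInjection elements selfConjugates fibre Tr shift (λ {x} _ → Tr-selfConjugate x) (λ {x} _ → Tr-shift x) shift-injective)

module _ {c ℓ} (F : CommutativeRing c ℓ) (q : ℕ) where
  open CommutativeRing F
  open Hermitian F q using (B; IsBasis)

  record IsWittBasis (u v w : V F) : Set (c ⊔ ℓ) where
    field
      isBasis : IsBasis u v w
      Buv≈1   : B u v ≈ 1#
      Bww≈1   : B w w ≈ 1#
      Buu≈0   : B u u ≈ 0#
      Bvv≈0   : B v v ≈ 0#
      Buw≈0   : B u w ≈ 0#
      Bvw≈0   : B v w ≈ 0#

module UnitaryGeometry {c ℓ} (F : CommutativeRing c ℓ) (isField : IsField F) (q : ℕ)
                       (isConjugation : IsConjugation F q)
                       (u v w : V F) (isWittBasis : IsWittBasis F q u v w) where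
  open CommutativeRing F hiding (zero)
  open FieldProperties F isField
  open Conjugation F isField q isConjugation
  open Hermitian F q hiding (conj)
  open Config u v w
  open IsWittBasis isWittBasis
  open import Data.Vec.Functional.Relation.Binary.Equality.Setoid setoid using (_≋_; ≋-refl; ≋-sym; ≋-trans)
  open import Algebra.Solver.Ring.NaturalCoefficients.Default commutativeSemiring
  open import Relation.Binary.Reasoning.Setoid setoid

  infixl 6 _+ᵥ_
  infixr 7 _·ᵥ_

  _+ᵥ_ : V F → V F → V F
  _+ᵥ_ = _+V_ F

  _·ᵥ_ : Carrier → V F → V F
  _·ᵥ_ = _·V_ F

  ⟪_,_,_⟫ : Carrier → Carrier → Carrier → V F
  ⟪ a , b , d ⟫ = a ·ᵥ u +ᵥ (b ·ᵥ v +ᵥ d ·ᵥ w)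

  ⟪⟫-cong : ∀ {a b d a′ b′ d′} → a ≈ a′ → b ≈ b′ → d ≈ d′ → ⟪ a , b , d ⟫ ≋ ⟪ a′ , b′ , d′ ⟫
  ⟪⟫-cong a≈ b≈ d≈ i = +-cong (*-congʳ a≈) (+-cong (*-congʳ b≈) (*-congʳ d≈))

  ⟪⟫-+ : ∀ a b d a′ b′ d′ → ⟪ a , b , d ⟫ +ᵥ ⟪ a′ , b′ , d′ ⟫ ≋ ⟪ a + a′ , b + b′ , d + d′ ⟫
  ⟪⟫-+ a b d a′ b′ d′ i = solve 9 (λ a b d a′ b′ d′ U X W →
    (a :* U :+ (b :* X :+ d :* W)) :+ (a′ :* U :+ (b′ :* X :+ d′ :* W))
    := (a :+ a′) :* U :+ ((b :+ b′) :* X :+ (d :+ d′) :* W)) refl a b d a′ b′ d′ (u i) (v i) (w i)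

  ⟪⟫-scale : ∀ s a b d → s ·ᵥ ⟪ a , b , d ⟫ ≋ ⟪ s * a , s * b , s * d ⟫
  ⟪⟫-scale s a b d i = solve 7 (λ s a b d U X W →
    s :* (a :* U :+ (b :* X :+ d :* W)) := s :* a :* U :+ (s :* b :* X :+ s :* d :* W)) refl s a b d (u i) (v i) (w i)

  ⟪⟫-injective : ∀ {a b d a′ b′ d′} → ⟪ a , b , d ⟫ ≋ ⟪ a′ , b′ , d′ ⟫ → a ≈ a′ × b ≈ b′ × d ≈ d′
  ⟪⟫-injective {a} {b} {d} {a′} {b′} {d′} eq =
    x∙y⁻¹≈ε⇒x≈y a a′ (proj₁ differences≈0) , x∙y⁻¹≈ε⇒x≈y b b′ (proj₁ (proj₂ differences≈0)) ,
    x∙y⁻¹≈ε⇒x≈y d d′ (proj₂ (proj₂ differences≈0))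
    where
    open import Algebra.Properties.Ring ring using (x∙y⁻¹≈ε⇒x≈y)
    difference≈0 : ⟪ a - a′ , b - b′ , d - d′ ⟫ ≋ (λ _ → 0#)
    difference≈0 i = begin
      ⟪ a - a′ , b - b′ , d - d′ ⟫ i              ≈⟨ ⟪⟫-+ a b d (- a′) (- b′) (- d′) i ⟨
      ⟪ a , b , d ⟫ i + ⟪ - a′ , - b′ , - d′ ⟫ i   ≈⟨ +-congʳ (eq i) ⟩
      ⟪ a′ , b′ , d′ ⟫ i + ⟪ - a′ , - b′ , - d′ ⟫ i ≈⟨ ⟪⟫-+ a′ b′ d′ (- a′) (- b′) (- d′) i ⟩
      ⟪ a′ - a′ , b′ - b′ , d′ - d′ ⟫ i            ≈⟨ ⟪⟫-cong (-‿inverseʳ a′) (-‿inverseʳ b′) (-‿inverseʳ d′) i ⟩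
      ⟪ 0# , 0# , 0# ⟫ i                          ≈⟨ solve 3 (λ U X W → con 0 :* U :+ (con 0 :* X :+ con 0 :* W) := con 0) refl (u i) (v i) (w i) ⟩
      0#                                          ∎
    differences≈0 = proj₁ isBasis (a - a′) (b - b′) (d - d′) difference≈0

  coord₁ coord₂ coord₃ : V F → Carrier
  coord₁ x = proj₁ (proj₂ isBasis x)
  coord₂ x = proj₁ (proj₂ (proj₂ isBasis x))
  coord₃ x = proj₁ (proj₂ (proj₂ (proj₂ isBasis x)))

  coords : ∀ x → x ≋ ⟪ coord₁ x , coord₂ x , coord₃ x ⟫
  coords x = proj₂ (proj₂ (proj₂ (proj₂ isBasis x)))

  coords-unique : ∀ {x a b d} → x ≋ ⟪ a , b , d ⟫ → coord₁ x ≈ a × coord₂ x ≈ b × coord₃ x ≈ d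
  coords-unique {x} x≋ = ⟪⟫-injective (≋-trans (≋-sym (coords x)) x≋)

  B-cong : ∀ {x x′ y y′} → x ≋ x′ → y ≋ y′ → B x y ≈ B x′ y′
  B-cong x≋ y≋ = +-cong (+-cong (*-cong (x≋ 0F) (conj-cong (y≋ 1F))) (*-cong (x≋ 1F) (conj-cong (y≋ 0F))))
                        (*-cong (x≋ 2F) (conj-cong (y≋ 2F)))

  B-homo-+ˡ : ∀ x y z → B (x +ᵥ y) z ≈ B x z + B y z
  B-homo-+ˡ x y z = solve 9 (λ x₀ x₁ x₂ y₀ y₁ y₂ z₀ z₁ z₂ →
    ((x₀ :+ y₀) :* z₁ :+ (x₁ :+ y₁) :* z₀) :+ (x₂ :+ y₂) :* z₂
    := ((x₀ :* z₁ :+ x₁ :* z₀) :+ x₂ :* z₂) :+ ((y₀ :* z₁ :+ y₁ :* z₀) :+ y₂ :* z₂))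
    refl (x 0F) (x 1F) (x 2F) (y 0F) (y 1F) (y 2F) (conj (z 0F)) (conj (z 1F)) (conj (z 2F))

  B-scaleˡ : ∀ s x z → B (s ·ᵥ x) z ≈ s * B x z
  B-scaleˡ s x z = solve 7 (λ s x₀ x₁ x₂ z₀ z₁ z₂ →
    (s :* x₀ :* z₁ :+ s :* x₁ :* z₀) :+ s :* x₂ :* z₂ := s :* ((x₀ :* z₁ :+ x₁ :* z₀) :+ x₂ :* z₂))
    refl s (x 0F) (x 1F) (x 2F) (conj (z 0F)) (conj (z 1F)) (conj (z 2F))

  B-hermitian : ∀ x y → B y x ≈ conj (B x y)
  B-hermitian x y = sym (begin
    conj ((x 0F * conj (y 1F) + x 1F * conj (y 0F)) + x 2F * conj (y 2F))
      ≈⟨ trans (conj-homo-+ _ _) (+-congʳ (conj-homo-+ _ _)) ⟩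
    (conj (x 0F * conj (y 1F)) + conj (x 1F * conj (y 0F))) + conj (x 2F * conj (y 2F))
      ≈⟨ +-cong (+-cong (flip 0F 1F) (flip 1F 0F)) (flip 2F 2F) ⟩
    (y 1F * conj (x 0F) + y 0F * conj (x 1F)) + y 2F * conj (x 2F)
      ≈⟨ +-congʳ (+-comm _ _) ⟩
    (y 0F * conj (x 1F) + y 1F * conj (x 0F)) + y 2F * conj (x 2F) ∎)
    where
    flip : ∀ i j → conj (x i * conj (y j)) ≈ y j * conj (x i)
    flip i j = trans (conj-homo-* _ _) (trans (*-congˡ (conj-involutive _)) (*-comm _ _))

  B-homo-+ʳ : ∀ x y z → B x (y +ᵥ z) ≈ B x y + B x z
  B-homo-+ʳ x y z = trans (B-hermitian (y +ᵥ z) x)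
    (trans (conj-cong (B-homo-+ˡ y z x)) (trans (conj-homo-+ _ _) (sym (+-cong (B-hermitian y x) (B-hermitian z x)))))

  B-scaleʳ : ∀ s x y → B x (s ·ᵥ y) ≈ conj s * B x y
  B-scaleʳ s x y = trans (B-hermitian (s ·ᵥ y) x)
    (trans (conj-cong (B-scaleˡ s y x)) (trans (conj-homo-* _ _) (*-congˡ (sym (B-hermitian y x)))))

  B-linearˡ : ∀ a b d y → B ⟪ a , b , d ⟫ y ≈ a * B u y + (b * B v y + d * B w y)
  B-linearˡ a b d y = begin
    B ⟪ a , b , d ⟫ y                                  ≈⟨ B-homo-+ˡ (a ·ᵥ u) (b ·ᵥ v +ᵥ d ·ᵥ w) y ⟩
    B (a ·ᵥ u) y + B (b ·ᵥ v +ᵥ d ·ᵥ w) y              ≈⟨ +-cong (B-scaleˡ a u y) (B-homo-+ˡ (b ·ᵥ v) (d ·ᵥ w) y) ⟩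
    a * B u y + (B (b ·ᵥ v) y + B (d ·ᵥ w) y)          ≈⟨ +-congˡ (+-cong (B-scaleˡ b v y) (B-scaleˡ d w y)) ⟩
    a * B u y + (b * B v y + d * B w y)                ∎

  B-linearʳ : ∀ a b d x → B x ⟪ a , b , d ⟫ ≈ conj a * B x u + (conj b * B x v + conj d * B x w)
  B-linearʳ a b d x = begin
    B x ⟪ a , b , d ⟫                                  ≈⟨ B-homo-+ʳ x (a ·ᵥ u) (b ·ᵥ v +ᵥ d ·ᵥ w) ⟩
    B x (a ·ᵥ u) + B x (b ·ᵥ v +ᵥ d ·ᵥ w)              ≈⟨ +-cong (B-scaleʳ a x u) (B-homo-+ʳ x (b ·ᵥ v) (d ·ᵥ w)) ⟩
    conj a * B x u + (B x (b ·ᵥ v) + B x (d ·ᵥ w))     ≈⟨ +-congˡ (+-cong (B-scaleʳ b x v) (B-scaleʳ d x w)) ⟩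
    conj a * B x u + (conj b * B x v + conj d * B x w) ∎

  private
    Bvu≈1 : B v u ≈ 1#
    Bvu≈1 = trans (B-hermitian u v) (trans (conj-cong Buv≈1) conj-1)
    Bwu≈0 : B w u ≈ 0#
    Bwu≈0 = trans (B-hermitian u w) (trans (conj-cong Buw≈0) conj-0)
    Bwv≈0 : B w v ≈ 0#
    Bwv≈0 = trans (B-hermitian v w) (trans (conj-cong Bvw≈0) conj-0)

    gram : ∀ {X Y Z} a b d y → B u y ≈ X → B v y ≈ Y → B w y ≈ Z →
           B ⟪ a , b , d ⟫ y ≈ a * X + (b * Y + d * Z)
    gram a b d y Buy Bvy Bwy = trans (B-linearˡ a b d y) (+-cong (*-congˡ Buy) (+-cong (*-congˡ Bvy) (*-congˡ Bwy)))

  B-⟪⟫-u : ∀ a b d → B ⟪ a , b , d ⟫ u ≈ b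
  B-⟪⟫-u a b d = trans (gram a b d u Buu≈0 Bvu≈1 Bwu≈0)
    (solve 3 (λ a b d → a :* con 0 :+ (b :* con 1 :+ d :* con 0) := b) refl a b d)

  B-⟪⟫-v : ∀ a b d → B ⟪ a , b , d ⟫ v ≈ a
  B-⟪⟫-v a b d = trans (gram a b d v Buv≈1 Bvv≈0 Bwv≈0)
    (solve 3 (λ a b d → a :* con 1 :+ (b :* con 0 :+ d :* con 0) := a) refl a b d)

  B-⟪⟫-w : ∀ a b d → B ⟪ a , b , d ⟫ w ≈ d
  B-⟪⟫-w a b d = trans (gram a b d w Buw≈0 Bvw≈0 Bww≈1)
    (solve 3 (λ a b d → a :* con 0 :+ (b :* con 0 :+ d :* con 1) := d) refl a b d)

  B-⟪⟫ : ∀ a b d a′ b′ d′ → B ⟪ a , b , d ⟫ ⟪ a′ , b′ , d′ ⟫ ≈ a * conj b′ + (b * conj a′ + d * conj d′)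
  B-⟪⟫ a b d a′ b′ d′ = begin
    B ⟪ a , b , d ⟫ ⟪ a′ , b′ , d′ ⟫
      ≈⟨ B-linearʳ a′ b′ d′ ⟪ a , b , d ⟫ ⟩
    conj a′ * B ⟪ a , b , d ⟫ u + (conj b′ * B ⟪ a , b , d ⟫ v + conj d′ * B ⟪ a , b , d ⟫ w)
      ≈⟨ +-cong (*-congˡ (B-⟪⟫-u a b d)) (+-cong (*-congˡ (B-⟪⟫-v a b d)) (*-congˡ (B-⟪⟫-w a b d))) ⟩
    conj a′ * b + (conj b′ * a + conj d′ * d)
      ≈⟨ solve 6 (λ a b d ā′ b̄′ d̄′ → ā′ :* b :+ (b̄′ :* a :+ d̄′ :* d) := a :* b̄′ :+ (b :* ā′ :+ d :* d̄′))
           refl a b d (conj a′) (conj b′) (conj d′) ⟩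
    a * conj b′ + (b * conj a′ + d * conj d′) ∎

  u-coords : ∀ a → a ·ᵥ u ≋ ⟪ a , 0# , 0# ⟫
  u-coords a i = solve 4 (λ a U X W → a :* U := a :* U :+ (con 0 :* X :+ con 0 :* W)) refl a (u i) (v i) (w i)

  v-coords : ∀ b → b ·ᵥ v ≋ ⟪ 0# , b , 0# ⟫
  v-coords b i = solve 4 (λ b U X W → b :* X := con 0 :* U :+ (b :* X :+ con 0 :* W)) refl b (u i) (v i) (w i)

  σ-⟪⟫ : ∀ (g : Unitary) a b d → let open Unitary g in
         σ ⟪ a , b , d ⟫ ≋ a ·ᵥ σ u +ᵥ (b ·ᵥ σ v +ᵥ d ·ᵥ σ w)
  σ-⟪⟫ g a b d = ≋-trans (additive (a ·ᵥ u) (b ·ᵥ v +ᵥ d ·ᵥ w))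
    (λ i → +-cong (homog a u i) (≋-trans (additive (b ·ᵥ v) (d ·ᵥ w)) (λ j → +-cong (homog b v j) (homog d w j)) i))
    where open Unitary g

  record Diagonal (g : Unitary) : Set (c ⊔ ℓ) where
    field
      α β γ : Carrier
      αβ̄≈1  : α * conj β ≈ 1#
      γγ̄≈1  : γ * conj γ ≈ 1#
      acts  : ∀ a b d → Unitary.σ g ⟪ a , b , d ⟫ ≋ ⟪ a * α , b * β , d * γ ⟫

  -- σ u = α u and σ v = β v; orthogonality to both forces σ w to be a multiple γ w of w.
  stabiliser-diagonal : ∀ g → InStab g → Diagonal g
  stabiliser-diagonal g ((α , α≉0 , σu≋αu) , (β , β≉0 , σv≋βv)) = record
    { α = α ; β = β ; γ = γ ; αβ̄≈1 = αβ̄≈1 ; γγ̄≈1 = γγ̄≈1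
    ; acts = λ a b d → ≋-trans (σ-⟪⟫ g a b d) (λ i → begin
        a * σ u i + (b * σ v i + d * σ w i)
          ≈⟨ +-cong (*-congˡ (σu≋ i)) (+-cong (*-congˡ (σv≋ i)) (*-congˡ (σw≋ i))) ⟩
        a * ⟪ α , 0# , 0# ⟫ i + (b * ⟪ 0# , β , 0# ⟫ i + d * ⟪ 0# , 0# , γ ⟫ i)
          ≈⟨ solve 9 (λ a b d α β γ U X W →
               a :* (α :* U :+ (con 0 :* X :+ con 0 :* W))
                 :+ (b :* (con 0 :* U :+ (β :* X :+ con 0 :* W)) :+ d :* (con 0 :* U :+ (con 0 :* X :+ γ :* W)))
               := a :* α :* U :+ (b :* β :* X :+ d :* γ :* W)) refl a b d α β γ (u i) (v i) (w i) ⟩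
        ⟪ a * α , b * β , d * γ ⟫ i ∎)
    }
    where
    open Unitary g
    σu≋ : σ u ≋ ⟪ α , 0# , 0# ⟫
    σu≋ = ≋-trans σu≋αu (u-coords α)
    σv≋ : σ v ≋ ⟪ 0# , β , 0# ⟫
    σv≋ = ≋-trans σv≋βv (v-coords β)
    a₁ = coord₁ (σ w)
    a₂ = coord₂ (σ w)
    γ  = coord₃ (σ w)
    a₁≈0 : a₁ ≈ 0#
    a₁≈0 = x*y≈0⇒y≈0 (conj-nonzero β≉0) (begin
      conj β * a₁                      ≈⟨ *-congˡ (B-⟪⟫-v a₁ a₂ γ) ⟨
      conj β * B ⟪ a₁ , a₂ , γ ⟫ v     ≈⟨ B-scaleʳ β ⟪ a₁ , a₂ , γ ⟫ v ⟨
      B ⟪ a₁ , a₂ , γ ⟫ (β ·ᵥ v)       ≈⟨ B-cong (≋-sym (coords (σ w))) (≋-sym σv≋βv) ⟩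
      B (σ w) (σ v)                    ≈⟨ isometry w v ⟩
      B w v                            ≈⟨ Bwv≈0 ⟩
      0#                               ∎)
    a₂≈0 : a₂ ≈ 0#
    a₂≈0 = x*y≈0⇒y≈0 (conj-nonzero α≉0) (begin
      conj α * a₂                      ≈⟨ *-congˡ (B-⟪⟫-u a₁ a₂ γ) ⟨
      conj α * B ⟪ a₁ , a₂ , γ ⟫ u     ≈⟨ B-scaleʳ α ⟪ a₁ , a₂ , γ ⟫ u ⟨
      B ⟪ a₁ , a₂ , γ ⟫ (α ·ᵥ u)       ≈⟨ B-cong (≋-sym (coords (σ w))) (≋-sym σu≋αu) ⟩
      B (σ w) (σ u)                    ≈⟨ isometry w u ⟩
      B w u                            ≈⟨ Bwu≈0 ⟩
      0#                               ∎)
    σw≋ : σ w ≋ ⟪ 0# , 0# , γ ⟫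
    σw≋ = ≋-trans (coords (σ w)) (⟪⟫-cong a₁≈0 a₂≈0 refl)
    αβ̄≈1 : α * conj β ≈ 1#
    αβ̄≈1 = begin
      α * conj β                       ≈⟨ *-comm α (conj β) ⟩
      conj β * α                       ≈⟨ *-congˡ (B-⟪⟫-v α 0# 0#) ⟨
      conj β * B ⟪ α , 0# , 0# ⟫ v     ≈⟨ B-scaleʳ β ⟪ α , 0# , 0# ⟫ v ⟨
      B ⟪ α , 0# , 0# ⟫ (β ·ᵥ v)       ≈⟨ B-cong (≋-sym σu≋) (≋-sym σv≋βv) ⟩
      B (σ u) (σ v)                    ≈⟨ isometry u v ⟩
      B u v                            ≈⟨ Buv≈1 ⟩
      1#                               ∎
    γγ̄≈1 : γ * conj γ ≈ 1#
    γγ̄≈1 = begin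
      γ * conj γ                                  ≈⟨ solve 3 (λ x y z → z := con 0 :* x :+ (con 0 :* y :+ z)) refl (conj 0#) (conj 0#) (γ * conj γ) ⟩
      0# * conj 0# + (0# * conj 0# + γ * conj γ)  ≈⟨ B-⟪⟫ 0# 0# γ 0# 0# γ ⟨
      B ⟪ 0# , 0# , γ ⟫ ⟪ 0# , 0# , γ ⟫            ≈⟨ B-cong (≋-sym σw≋) (≋-sym σw≋) ⟩
      B (σ w) (σ w)                               ≈⟨ isometry w w ⟩
      B w w                                       ≈⟨ Bww≈1 ⟩
      1#                                          ∎

  module _ {α β γ : Carrier} (αβ̄≈1 : α * conj β ≈ 1#) (γγ̄≈1 : γ * conj γ ≈ 1#) where

    dilate : V F → V F
    dilate x = ⟪ coord₁ x * α , coord₂ x * β , coord₃ x * γ ⟫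

    dilate-⟪⟫ : ∀ {x a b d} → x ≋ ⟪ a , b , d ⟫ → dilate x ≋ ⟪ a * α , b * β , d * γ ⟫
    dilate-⟪⟫ x≋ = ⟪⟫-cong (*-congʳ (proj₁ same)) (*-congʳ (proj₁ (proj₂ same))) (*-congʳ (proj₂ (proj₂ same)))
      where same = coords-unique x≋

    private
      α≉0 : α ≉ 0#
      α≉0 = *-inverse-nonzeroˡ αβ̄≈1
      β≉0 : β ≉ 0#
      β≉0 = x*conj-y≈1⇒y≉0 αβ̄≈1
      γ≉0 : γ ≉ 0#
      γ≉0 = *-inverse-nonzeroˡ γγ̄≈1
      βᾱ≈1 : β * conj α ≈ 1#
      βᾱ≈1 = begin
        β * conj α              ≈⟨ *-congʳ (conj-involutive β) ⟨
        conj (conj β) * conj α  ≈⟨ conj-homo-* (conj β) α ⟨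
        conj (conj β * α)       ≈⟨ conj-cong (*-comm _ _) ⟩
        conj (α * conj β)       ≈⟨ conj-cong αβ̄≈1 ⟩
        conj 1#                 ≈⟨ conj-1 ⟩
        1#                      ∎
      unit-cancels : ∀ {s t} → s * conj t ≈ 1# → ∀ a b → (a * s) * conj (b * t) ≈ a * conj b
      unit-cancels {s} {t} st̄≈1 a b = begin
        (a * s) * conj (b * t)      ≈⟨ *-congˡ (conj-homo-* b t) ⟩
        (a * s) * (conj b * conj t) ≈⟨ solve 4 (λ a s b̄ t̄ → (a :* s) :* (b̄ :* t̄) := (a :* b̄) :* (s :* t̄)) refl a s (conj b) (conj t) ⟩
        (a * conj b) * (s * conj t) ≈⟨ *-congˡ st̄≈1 ⟩
        (a * conj b) * 1#           ≈⟨ *-identityʳ _ ⟩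
        a * conj b                  ∎
      rescale : ∀ {s} (s≉0 : s ≉ 0#) a → (a * inv s s≉0) * s ≈ a
      rescale {s} s≉0 a = trans (*-assoc _ _ _) (trans (*-congˡ (inverseˡ s s≉0)) (*-identityʳ a))

    dilate-cong : ∀ {x y} → x ≋ y → dilate x ≋ dilate y
    dilate-cong {x} {y} x≋y = dilate-⟪⟫ (≋-trans x≋y (coords y))

    dilate-+ : ∀ x y → dilate (x +ᵥ y) ≋ dilate x +ᵥ dilate y
    dilate-+ x y = ≋-trans (dilate-⟪⟫ x+y≋) (≋-trans
      (⟪⟫-cong (distribʳ α (coord₁ x) (coord₁ y)) (distribʳ β (coord₂ x) (coord₂ y)) (distribʳ γ (coord₃ x) (coord₃ y)))
      (≋-sym (⟪⟫-+ (coord₁ x * α) (coord₂ x * β) (coord₃ x * γ) (coord₁ y * α) (coord₂ y * β) (coord₃ y * γ))))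
      where
      x+y≋ : x +ᵥ y ≋ ⟪ coord₁ x + coord₁ y , coord₂ x + coord₂ y , coord₃ x + coord₃ y ⟫
      x+y≋ = ≋-trans (λ i → +-cong (coords x i) (coords y i)) (⟪⟫-+ (coord₁ x) (coord₂ x) (coord₃ x) (coord₁ y) (coord₂ y) (coord₃ y))

    dilate-scale : ∀ s x → dilate (s ·ᵥ x) ≋ s ·ᵥ dilate x
    dilate-scale s x = ≋-trans (dilate-⟪⟫ sx≋) (≋-trans
      (⟪⟫-cong (*-assoc s (coord₁ x) α) (*-assoc s (coord₂ x) β) (*-assoc s (coord₃ x) γ))
      (≋-sym (⟪⟫-scale s (coord₁ x * α) (coord₂ x * β) (coord₃ x * γ))))
      where
      sx≋ : s ·ᵥ x ≋ ⟪ s * coord₁ x , s * coord₂ x , s * coord₃ x ⟫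
      sx≋ = ≋-trans (λ i → *-congˡ (coords x i)) (⟪⟫-scale s (coord₁ x) (coord₂ x) (coord₃ x))

    dilate-injective : ∀ x y → dilate x ≋ dilate y → x ≋ y
    dilate-injective x y dx≋dy = ≋-trans (coords x) (≋-trans
      (⟪⟫-cong (*-cancelʳ α≉0 (proj₁ same)) (*-cancelʳ β≉0 (proj₁ (proj₂ same))) (*-cancelʳ γ≉0 (proj₂ (proj₂ same))))
      (≋-sym (coords y)))
      where same = ⟪⟫-injective dx≋dy

    dilate-surjective : ∀ y → ∃[ x ] dilate x ≋ y
    dilate-surjective y = x , ≋-trans (dilate-⟪⟫ ≋-refl)
      (≋-trans (⟪⟫-cong (rescale α≉0 (coord₁ y)) (rescale β≉0 (coord₂ y)) (rescale γ≉0 (coord₃ y))) (≋-sym (coords y)))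
      where x = ⟪ coord₁ y * inv α α≉0 , coord₂ y * inv β β≉0 , coord₃ y * inv γ γ≉0 ⟫

    dilate-isometry : ∀ x y → B (dilate x) (dilate y) ≈ B x y
    dilate-isometry x y = begin
      B (dilate x) (dilate y)
        ≈⟨ B-⟪⟫ (coord₁ x * α) (coord₂ x * β) (coord₃ x * γ) (coord₁ y * α) (coord₂ y * β) (coord₃ y * γ) ⟩
      coord₁ x * α * conj (coord₂ y * β) + (coord₂ x * β * conj (coord₁ y * α) + coord₃ x * γ * conj (coord₃ y * γ))
        ≈⟨ +-cong (unit-cancels αβ̄≈1 (coord₁ x) (coord₂ y))
                  (+-cong (unit-cancels βᾱ≈1 (coord₂ x) (coord₁ y)) (unit-cancels γγ̄≈1 (coord₃ x) (coord₃ y))) ⟩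
      coord₁ x * conj (coord₂ y) + (coord₂ x * conj (coord₁ y) + coord₃ x * conj (coord₃ y))
        ≈⟨ B-⟪⟫ (coord₁ x) (coord₂ x) (coord₃ x) (coord₁ y) (coord₂ y) (coord₃ y) ⟨
      B ⟪ coord₁ x , coord₂ x , coord₃ x ⟫ ⟪ coord₁ y , coord₂ y , coord₃ y ⟫
        ≈⟨ B-cong (coords x) (coords y) ⟨
      B x y ∎

    dilation : Unitary
    dilation = record
      { σ = dilate ; cong = dilate-cong ; additive = dilate-+ ; homog = dilate-scale
      ; injective = dilate-injective ; surjective = dilate-surjective ; isometry = dilate-isometry }

    dilation-stabilises : InStab dilation
    dilation-stabilises = (α , α≉0 , ≋-trans (dilate-⟪⟫ (≋-trans (λ i → sym (*-identityˡ (u i))) (u-coords 1#)))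
                                       (≋-trans (⟪⟫-cong (*-identityˡ α) (zeroˡ β) (zeroˡ γ)) (≋-sym (u-coords α))))
                        , (β , β≉0 , ≋-trans (dilate-⟪⟫ (≋-trans (λ i → sym (*-identityˡ (v i))) (v-coords 1#)))
                                       (≋-trans (⟪⟫-cong (zeroˡ α) (*-identityˡ β) (zeroˡ γ)) (≋-sym (v-coords β))))

  ω : Carrier → Carrier → V F
  ω b d = b ·ᵥ u +ᵥ (v +ᵥ d ·ᵥ w)

  ω≋⟪⟫ : ∀ b d → ω b d ≋ ⟪ b , 1# , d ⟫
  ω≋⟪⟫ b d i = +-congˡ (+-congʳ (sym (*-identityˡ (v i))))

  OnΩ′ : Carrier → Carrier → Set ℓ
  OnΩ′ b d = (Tr b + norm d ≈ 0#) × Tr b ≉ 0#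

  OnΩ′⇒d≉0 : ∀ {b d} → OnΩ′ b d → d ≉ 0#
  OnΩ′⇒d≉0 {b} {d} (Tr-b+Nd≈0 , Tr-b≉0) d≈0 = Tr-b≉0 (begin
    Tr b                ≈⟨ +-identityʳ (Tr b) ⟨
    Tr b + 0#           ≈⟨ +-congˡ (trans (*-congʳ d≈0) (zeroˡ _)) ⟨
    Tr b + norm d       ≈⟨ Tr-b+Nd≈0 ⟩
    0#                  ∎)

  OnΩ′-rescale : ∀ {b d b′ d′ N} → N ≉ 0# → SelfConjugate N → b′ * N ≈ b → norm d′ * N ≈ norm d →
                 OnΩ′ b d → OnΩ′ b′ d′
  OnΩ′-rescale {b} {d} {b′} {d′} {N} N≉0 N-sc b′N≈b d′N≈d (Tr-b+Nd≈0 , Tr-b≉0) =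
    x*y≈0⇒y≈0 N≉0 (trans (*-comm _ _) (trans (distribʳ N _ _) (trans (+-cong Tr-b′N≈Tr-b d′N≈d) Tr-b+Nd≈0))) ,
    λ Tr-b′≈0 → Tr-b≉0 (trans (sym Tr-b′N≈Tr-b) (trans (*-congʳ Tr-b′≈0) (zeroˡ N)))
    where
    Tr-b′N≈Tr-b : Tr b′ * N ≈ Tr b
    Tr-b′N≈Tr-b = begin
      (b′ + conj b′) * N         ≈⟨ distribʳ N b′ (conj b′) ⟩
      b′ * N + conj b′ * N       ≈⟨ +-congˡ (*-congˡ N-sc) ⟨
      b′ * N + conj b′ * conj N  ≈⟨ +-congˡ (conj-homo-* b′ N) ⟨
      b′ * N + conj (b′ * N)     ≈⟨ Tr-cong b′N≈b ⟩
      Tr b                       ∎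

  σ-line : ∀ g {x y z λ′ μ} → x ≋ λ′ ·ᵥ y → Unitary.σ g y ≋ μ ·ᵥ z → Unitary.σ g x ≋ (λ′ * μ) ·ᵥ z
  σ-line g {λ′ = λ′} {μ} x≋ σy≋ =
    ≋-trans (cong x≋) (≋-trans (homog λ′ _) (λ i → trans (*-congˡ (σy≋ i)) (sym (*-assoc λ′ μ _))))
    where open Unitary g

  diagonal-ω : ∀ {g} (D : Diagonal g) → let open Diagonal D in
               (β≉0 : β ≉ 0#) → ∀ b d → Unitary.σ g (ω b d) ≋ β ·ᵥ ω (b * α * inv β β≉0) (d * γ * inv β β≉0)
  diagonal-ω {g} D β≉0 b d =
    ≋-trans (Unitary.cong g (ω≋⟪⟫ b d)) (≋-trans (acts b 1# d) (≋-trans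
      (⟪⟫-cong (cancel (b * α)) (trans (*-identityˡ β) (sym (*-identityʳ β))) (cancel (d * γ)))
      (≋-trans (≋-sym (⟪⟫-scale β _ _ _)) (λ i → *-congˡ (sym (ω≋⟪⟫ _ _ i))))))
    where
    open Diagonal D
    β⁻¹ = inv β β≉0
    cancel : ∀ t → t ≈ β * (t * β⁻¹)
    cancel t = sym (trans (*-comm β _) (trans (*-assoc t β⁻¹ β) (trans (*-congˡ (inverseˡ β β≉0)) (*-identityʳ t))))

  stabiliser-acts : StabActsOnΩ′
  stabiliser-acts g x g-stab (b , d , Ω-eq , Ω-ne , Bxx≈0 , (λ′ , λ′≉0 , x≋λ′ω)) =
    b′ , d′ , proj₁ onΩ′ , proj₂ onΩ′ , trans (isometry x x) Bxx≈0 ,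
    (λ′ * β , *-nonzero λ′≉0 β≉0 , σ-line g x≋λ′ω (diagonal-ω D β≉0 b d))
    where
    open Unitary g
    D = stabiliser-diagonal g g-stab
    open Diagonal D
    β≉0 = x*conj-y≈1⇒y≉0 αβ̄≈1
    β⁻¹ = inv β β≉0
    b′ = b * α * β⁻¹
    d′ = d * γ * β⁻¹
    β⁻¹β≈1 = inverseˡ β β≉0
    b′Nβ≈b : b′ * norm β ≈ b
    b′Nβ≈b = begin
      b * α * β⁻¹ * (β * conj β)    ≈⟨ solve 5 (λ b α β⁻¹ β β̄ → b :* α :* β⁻¹ :* (β :* β̄) := b :* (α :* β̄) :* (β⁻¹ :* β)) refl b α β⁻¹ β (conj β) ⟩
      b * (α * conj β) * (β⁻¹ * β)  ≈⟨ *-cong (*-congˡ αβ̄≈1) β⁻¹β≈1 ⟩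
      b * 1# * 1#                   ≈⟨ trans (*-identityʳ _) (*-identityʳ b) ⟩
      b                             ∎
    d′Nβ≈Nd : norm d′ * norm β ≈ norm d
    d′Nβ≈Nd = begin
      norm (d * γ * β⁻¹) * norm β          ≈⟨ *-congʳ (trans (norm-homo-* _ β⁻¹) (*-congʳ (norm-homo-* d γ))) ⟩
      norm d * norm γ * norm β⁻¹ * norm β  ≈⟨ *-assoc _ _ _ ⟩
      norm d * norm γ * (norm β⁻¹ * norm β) ≈⟨ *-cong (*-congˡ γγ̄≈1) (trans (sym (norm-homo-* β⁻¹ β)) (trans (*-cong β⁻¹β≈1 (conj-cong β⁻¹β≈1)) norm-1)) ⟩
      norm d * 1# * 1#                     ≈⟨ trans (*-identityʳ _) (*-identityʳ _) ⟩
      norm d                               ∎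
    onΩ′ : OnΩ′ b′ d′
    onΩ′ = OnΩ′-rescale (norm-nonzero β≉0) (norm-selfConjugate β) b′Nβ≈b d′Nβ≈Nd (Ω-eq , Ω-ne)

  module _ {m} (E : Enumerations.Enumeration setoid (λ r → Tr r ≈ - 1#) m) where
    open Enumerations.Enumeration E

    representative : Fin m → V F
    representative i = ω (enum i) 1#

    representative-in-Ω′ : ∀ i → InΩ′ (representative i)
    representative-in-Ω′ i = r , 1# , Tr-r+N1≈0 , (λ Tr-r≈0 → -1≉0 (trans (sym (sound i)) Tr-r≈0)) , Bωω≈0 ,
                             (1# , 1≉0 , λ j → sym (*-identityˡ _))
      where
      r = enum i
      Tr-r+N1≈0 : Tr r + norm 1# ≈ 0#
      Tr-r+N1≈0 = trans (+-cong (sound i) norm-1) (-‿inverseˡ 1#)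
      Bωω≈0 : B (ω r 1#) (ω r 1#) ≈ 0#
      Bωω≈0 = begin
        B (ω r 1#) (ω r 1#)                             ≈⟨ B-cong (ω≋⟪⟫ r 1#) (ω≋⟪⟫ r 1#) ⟩
        B ⟪ r , 1# , 1# ⟫ ⟪ r , 1# , 1# ⟫               ≈⟨ B-⟪⟫ r 1# 1# r 1# 1# ⟩
        r * conj 1# + (1# * conj r + 1# * conj 1#)      ≈⟨ +-cong (*-congˡ conj-1) (+-congˡ (*-congˡ conj-1)) ⟩
        r * 1# + (1# * conj r + 1# * 1#)                ≈⟨ solve 2 (λ r r̄ → r :* con 1 :+ (con 1 :* r̄ :+ con 1 :* con 1) := (r :+ r̄) :+ con 1) refl r (conj r) ⟩
        Tr r + 1#                                       ≈⟨ +-congʳ (sound i) ⟩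
        - 1# + 1#                                       ≈⟨ -‿inverseˡ 1# ⟩
        0#                                              ∎

    -- A diagonal g with σ [rᵢ u + v + w] = [rⱼ u + v + w] has β = γ, so rᵢ = rᵢ α β̄ = rⱼ γ γ̄ = rⱼ.
    representatives-distinct : ∀ i j → SameOrbit (representative i) (representative j) → i ≡ j
    representatives-distinct i j (g , g-stab , (λ′ , _ , σωᵢ≋λ′ωⱼ)) = injective (begin
      rᵢ                    ≈⟨ *-identityʳ rᵢ ⟨
      rᵢ * 1#               ≈⟨ *-congˡ αβ̄≈1 ⟨
      rᵢ * (α * conj β)     ≈⟨ *-assoc rᵢ α (conj β) ⟨
      rᵢ * α * conj β       ≈⟨ *-cong rᵢα≈λ′rⱼ (conj-cong (trans β≈λ′ (sym γ≈λ′))) ⟩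
      λ′ * rⱼ * conj γ      ≈⟨ *-congʳ (*-comm λ′ rⱼ) ⟩
      rⱼ * λ′ * conj γ      ≈⟨ *-assoc rⱼ λ′ (conj γ) ⟩
      rⱼ * (λ′ * conj γ)    ≈⟨ *-congˡ (trans (*-congʳ (sym γ≈λ′)) γγ̄≈1) ⟩
      rⱼ * 1#               ≈⟨ *-identityʳ rⱼ ⟩
      rⱼ                    ∎)
      where
      open Diagonal (stabiliser-diagonal g g-stab)
      rᵢ = enum i
      rⱼ = enum j
      coefficients = ⟪⟫-injective (≋-trans (≋-sym (acts rᵢ 1# 1#)) (≋-trans (Unitary.cong g (≋-sym (ω≋⟪⟫ rᵢ 1#)))
                       (≋-trans σωᵢ≋λ′ωⱼ (≋-trans (λ k → *-congˡ (ω≋⟪⟫ rⱼ 1# k)) (⟪⟫-scale λ′ rⱼ 1# 1#)))))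
      rᵢα≈λ′rⱼ : rᵢ * α ≈ λ′ * rⱼ
      rᵢα≈λ′rⱼ = proj₁ coefficients
      β≈λ′ : β ≈ λ′
      β≈λ′ = trans (sym (*-identityˡ β)) (trans (proj₁ (proj₂ coefficients)) (*-identityʳ λ′))
      γ≈λ′ : γ ≈ λ′
      γ≈λ′ = trans (sym (*-identityˡ γ)) (trans (proj₂ (proj₂ coefficients)) (*-identityʳ λ′))

    -- [b u + v + d w] is moved to [r u + v + w] with r = b / (d d̄) by the dilation (d / (d d̄), d, 1).
    representatives-cover : ∀ x → InΩ′ x → ∃[ i ] SameOrbit x (representative i)
    representatives-cover x (b , d , Ω-eq , Ω-ne , _ , (λ′ , λ′≉0 , x≋λ′ω)) =
      i , g , dilation-stabilises αβ̄≈1 norm-1 , (λ′ * d , *-nonzero λ′≉0 d≉0 , σ-line g x≋λ′ω σω≋dωᵢ)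
      where
      d≉0 = OnΩ′⇒d≉0 (Ω-eq , Ω-ne)
      N⁻¹ = inv (norm d) (norm-nonzero d≉0)
      r = b * N⁻¹
      N⁻¹N≈1 : N⁻¹ * norm d ≈ 1#
      N⁻¹N≈1 = inverseˡ (norm d) (norm-nonzero d≉0)
      Tr-r≈-1 : Tr r ≈ - 1#
      Tr-r≈-1 = trans (+-inverseˡ-unique (Tr r) (norm 1#) (proj₁ onΩ′)) (-‿cong norm-1)
        where
        open import Algebra.Properties.Ring ring using (+-inverseˡ-unique)
        onΩ′ : OnΩ′ r 1#
        onΩ′ = OnΩ′-rescale (norm-nonzero d≉0) (norm-selfConjugate d)
                 (trans (*-assoc b N⁻¹ _) (trans (*-congˡ N⁻¹N≈1) (*-identityʳ b)))
                 (trans (*-congʳ norm-1) (*-identityˡ _)) (Ω-eq , Ω-ne)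
      i = proj₁ (complete {r} Tr-r≈-1)
      r≈rᵢ = proj₂ (complete {r} Tr-r≈-1)
      α = d * N⁻¹
      αβ̄≈1 : α * conj d ≈ 1#
      αβ̄≈1 = trans (*-assoc d N⁻¹ _) (trans (*-congˡ (*-comm N⁻¹ _)) (trans (sym (*-assoc d _ N⁻¹))
               (trans (*-comm _ N⁻¹) N⁻¹N≈1)))
      g = dilation αβ̄≈1 norm-1
      σω≋dωᵢ : Unitary.σ g (ω b d) ≋ d ·ᵥ ω (enum i) 1#
      σω≋dωᵢ = ≋-trans (dilate-⟪⟫ αβ̄≈1 norm-1 (ω≋⟪⟫ b d)) (≋-trans
        (⟪⟫-cong (trans (solve 3 (λ b d N⁻¹ → b :* (d :* N⁻¹) := d :* (b :* N⁻¹)) refl b d N⁻¹) (*-congˡ r≈rᵢ))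
                 (trans (*-identityˡ d) (sym (*-identityʳ d))) refl)
        (≋-trans (≋-sym (⟪⟫-scale d _ _ _)) (λ k → *-congˡ (sym (ω≋⟪⟫ (enum i) 1# k)))))

    orbit-count : HasOrbitCount m
    orbit-count = representative , representative-in-Ω′ , representatives-distinct , representatives-cover

open import Data.Nat using (_^_)

proposition3p2 : {c ℓ : Level} (q : ℕ) → IsPrimePower q
    → (F : CommutativeRing c ℓ) → IsField F → HasCardinality F (q ^ 2)
    → (u v w : V F)
    → Hermitian.IsBasis F q u v w
    → let open CommutativeRing F
          open Hermitian F q
      in (B u v ≈ 1#) → (B w w ≈ 1#) → (B u u ≈ 0#) → (B v v ≈ 0#)
         → (B u w ≈ 0#) → (B v w ≈ 0#)
         → Config.StabActsOnΩ′ u v w × Config.HasOrbitCount u v w q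
proposition3p2 q q-primePower F isField card u v w isBasis Buv≈1 Bww≈1 Buu≈0 Bvv≈0 Buw≈0 Bvw≈0 =
  stabiliser-acts , orbit-count (trace-fibre (selfConjugate-- conj-1))
  where
  open FieldOfSquareOrder F isField q q-primePower card
  isWittBasis : IsWittBasis F q u v w
  isWittBasis = record { isBasis = isBasis ; Buv≈1 = Buv≈1 ; Bww≈1 = Bww≈1 ; Buu≈0 = Buu≈0
                       ; Bvv≈0 = Bvv≈0 ; Buw≈0 = Buw≈0 ; Bvw≈0 = Bvw≈0 }
  open UnitaryGeometry F isField q isConjugation u v w isWittBasis
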